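{- Let $L$ be an odd positive integer, $N>1$ an integer, $w(y,y')\in\mathbb{C}$ for $y,y'\in\{0,\dots,L\}$ with $|y-y'|=1$, $v(y)\in\mathbb{C}$ for $y\in\{0,\dots,L\}$. Let $\mathcal{K}_1$ be a finite totally ordered index set, and suppose that for each $k\in\mathcal{K}_1$ there are $\lambda_k\in\mathbb{C}$, column vectors $R^{o}_{k}\in\mathbb{C}^{\mathcal{S}^{o}_{L}}$, $R^{e}_{k}\in\mathbb{C}^{\mathcal{S}^{e}_{L}}$ and row vectors $L^{o}_{k}$, $L^{e}_{k}$ indexed by $\mathcal{S}^{o}_{L}$, $\mathcal{S}^{e}_{L}$, such that: (1) $\{R^{p}_k\}_{k}$ is linearly independent and spanning for each $p\in\{e,o\}$, with $\mathbf{T}^{eo}_{1}R^{o}_{k}=\lambda_kR^{e}_{k}$ and $\mathbf{T}^{oe}_{1}R^{e}_{k}=\lambda_kR^{o}_{k}$; (2) for each $p$, $\sum_{y\in\mathcal{S}^p_L}\overline{L^{p}_{k}(y)}R^{p}_{k'}(y)=\delta_{k,k'}$ and $\sum_{k\in\mathcal{K}_1}R^{p}_{k}(y)\overline{L^{p}_{k}(y')}=\delta_{y,y'}$; (3) $L^{o}_{k}\mathbf{T}^{oe}_{1}=\lambda_kL^{e}_{k}$ and $L^{e}_{k}\mathbf{T}^{eo}_{1}=\lambda_kL^{o}_{k}$. Let $t\ge0$ be an integer and $p,p'\in\{e,o\}$ with $p'=p$ if $t$ is even and $p'\neq p$ if $t$ is odd. Then for all ${\bf y}^{i}\in\mathcal{U}^{p'}_{L}$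 and ${\bf y}^{f}\in\mathcal{U}^{p}_{L}$, $$Z^{\mathcal N}_{t}({\bf y}^{i}\to{\bf y}^{f})=V({\bf y}^{i})\sum_{{\bf k}\in\mathcal{K}_N}E^{p'}_{R,{\bf k}}({\bf y}^{i})\,\Lambda_{\bf k}^{t}\,\overline{E^{p}_{L,{\bf k}}({\bf y}^{f})}.$$
   Context: Notation: $\mathcal{S}^{o}_{L}$ is the set of odd integers in $[1,L]$, $\mathcal{S}^{e}_{L}$ the set of even integers in $[0,L]$; $\mathcal{U}^{p}_{L}=\{(y_1,\dots,y_N): y_1<\dots<y_N,\ y_j\in\mathcal{S}^{p}_{L}\}$. $V({\bf y})=\prod_{\alpha=1}^{N}v(y_\alpha)$. Bar denotes complex conjugation. $\mathcal{K}_N=\{(k_1,\dots,k_N): k_j\in\mathcal{K}_1,\ k_1<\dots<k_N\}$, $\Lambda_{\bf k}=\prod_{\alpha}\lambda_{k_\alpha}$, and for $C\in\{R,L\}$, $E^{p}_{C,{\bf k}}({\bf y})=\sum_{\sigma\in P_N}\epsilon_\sigma\prod_{\alpha=1}^{N}C^{p}_{k_{\sigma_\alpha}}(y_\alpha)$ for ${\bf y}\in\mathcal{U}^{p}_{L}$, where $P_N$ is the set of permutations of $\{1,\dots,N\}$ and $\epsilon_\sigma$ the sign. Generating function: $Z^{\mathcal N}_{t}({\bf a}\to{\bf b})$ is the sum, over all families of integers $(y_j(m))_{1\le j\le N,\,0\le m\le t}$ with $0\le y_1(m)<\dots<y_N(m)\le L$ for every $m$, $|y_j(m)-y_j(m-1)|=1$,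 $y_j(0)=a_j$, $y_j(t)=b_j$, of $\prod_{j=1}^{N}v(y_j(0))\prod_{m=1}^{t}w(y_j(m-1),y_j(m))$. Transfer matrices: for $\{a,b\}=\{e,o\}$, $\mathbf{T}^{ab}_{1}$ has rows indexed by $\mathcal{S}^{a}_{L}$, columns by $\mathcal{S}^{b}_{L}$, entries $w(y,y')$ if $|y-y'|=1$ and $0$ otherwise. -}

module Defs where

open import Level using (_⊔_)
open import Algebra.Bundles using (CommutativeRing)
open import Data.Nat using (ℕ; zero; suc; _≤_; _≡ᵇ_; _<ᵇ_; ∣_-_∣)
open import Data.Bool using (Bool; true; false; if_then_else_; _∧_; not)
open import Data.List using (List; []; _∷_; _++_; map; concatMap; upTo; allFin; filterᵇ)
open import Data.Vec using (Vec; []; _∷_; lookup)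
open import Data.Fin using (Fin; toℕ)
open import Data.Product using (∃; _×_)
open import Relation.Binary.PropositionalEquality using (_≡_)

data Par : Set where
  e o : Par

flipP : Par → Par
flipP e = o
flipP o = e

flipN : ℕ → Par → Par
flipN zero p = p
flipN (suc t) p = flipP (flipN t p)

parOf : ℕ → Par
parOf zero = e
parOf (suc zero) = o
parOf (suc (suc n)) = parOf n

_==P_ : Par → Par → Bool
e ==P e = true
o ==P o = true
_ ==P _ = false

InS : Par → ℕ → ℕ → Set
InS p L y = (y ≤ L) × (parOf y ≡ p)

sites : Par → ℕ → List ℕ
sites p L = filterᵇ (λ y → parOf y ==P p) (upTo (suc L))

allVecs : {A : Set} → List A → (n : ℕ) → List (Vec A n)
allVecs xs zero = [] ∷ []
allVecs xs (suc n) = concatMap (λ x → map (x ∷_) (allVecs xs n)) xs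

strictIncℕ : {n : ℕ} → Vec ℕ n → Bool
strictIncℕ [] = true
strictIncℕ (x ∷ []) = true
strictIncℕ (x ∷ y ∷ ys) = (x <ᵇ y) ∧ strictIncℕ (y ∷ ys)

strictIncFin : {K n : ℕ} → Vec (Fin K) n → Bool
strictIncFin [] = true
strictIncFin (x ∷ []) = true
strictIncFin (x ∷ y ∷ ys) = (toℕ x <ᵇ toℕ y) ∧ strictIncFin (y ∷ ys)

eqVec : {n : ℕ} → Vec ℕ n → Vec ℕ n → Bool
eqVec [] [] = true
eqVec (x ∷ xs) (y ∷ ys) = (x ≡ᵇ y) ∧ eqVec xs ys

InU : {N : ℕ} → Par → ℕ → Vec ℕ N → Set
InU {N} p L y = (strictIncℕ y ≡ true) × (∀ (α : Fin N) → InS p L (lookup y α))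

configs : (N L : ℕ) → List (Vec ℕ N)
configs N L = filterᵇ strictIncℕ (allVecs (upTo (suc L)) N)

-- 𝒦_N for 𝒦_1 = Fin K with its natural order
Kset : (K N : ℕ) → List (Vec (Fin K) N)
Kset K N = filterᵇ strictIncFin (allVecs (allFin K) N)

memFin : {N n : ℕ} → Fin N → Vec (Fin N) n → Bool
memFin i [] = false
memFin i (j ∷ js) = if toℕ i ≡ᵇ toℕ j then true else memFin i js

noDup : {N n : ℕ} → Vec (Fin N) n → Bool
noDup [] = true
noDup (i ∷ is) = not (memFin i is) ∧ noDup is

perms : (N : ℕ) → List (Vec (Fin N) N)
perms N = filterᵇ noDup (allVecs (allFin N) N)

countGt : {N n : ℕ} → Fin N → Vec (Fin N) n → ℕ
countGt i [] = zero
countGt i (j ∷ js) = if toℕ j <ᵇ toℕ i then suc (countGt i js) else countGt i js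

inversions : {N n : ℕ} → Vec (Fin N) n → ℕ
inversions [] = zero
inversions (i ∷ is) = countGt i is Data.Nat.+ inversions is

isEven : ℕ → Bool
isEven zero = true
isEven (suc n) = not (isEven n)

module _ {c ℓ} (R : CommutativeRing c ℓ) where
  open CommutativeRing R

  -- complex conjugation: an involutive ring automorphism
  record Conj : Set (c ⊔ ℓ) where
    field
      conj       : Carrier → Carrier
      conj-cong  : ∀ {x y} → x ≈ y → conj x ≈ conj y
      conj-+     : ∀ x y → conj (x + y) ≈ conj x + conj y
      conj-*     : ∀ x y → conj (x * y) ≈ conj x * conj y
      conj-1     : conj 1# ≈ 1#
      conj-invol : ∀ x → conj (conj x) ≈ x

  sumOver : {A : Set} → List A → (A → Carrier) → Carrier
  sumOver [] f = 0#
  sumOver (x ∷ xs) f = f x + sumOver xs f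

  prodOver : {A : Set} → List A → (A → Carrier) → Carrier
  prodOver [] f = 1#
  prodOver (x ∷ xs) f = f x * prodOver xs f

  pow : Carrier → ℕ → Carrier
  pow x zero = 1#
  pow x (suc n) = x * pow x n

  δ : Bool → Carrier
  δ b = if b then 1# else 0#

  sgn : {N : ℕ} → Vec (Fin N) N → Carrier
  sgn σ = if isEven (inversions σ) then 1# else - 1#

  Tent : (ℕ → ℕ → Carrier) → ℕ → ℕ → Carrier
  Tent w y y' = if ∣ y - y' ∣ ≡ᵇ 1 then w y y' else 0#

  Vw : {N : ℕ} → (ℕ → Carrier) → Vec ℕ N → Carrier
  Vw {N} v y = prodOver (allFin N) (λ α → v (lookup y α))

  stepsOK : {N t : ℕ} → Vec (Vec ℕ N) (suc t) → Bool
  stepsOK (y ∷ []) = true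
  stepsOK {N} (y ∷ y' ∷ ys) =
    allB (allFin N) (λ j → ∣ lookup y j - lookup y' j ∣ ≡ᵇ 1) ∧ stepsOK (y' ∷ ys)
    where
    allB : {A : Set} → List A → (A → Bool) → Bool
    allB [] f = true
    allB (x ∷ xs) f = f x ∧ allB xs f

  stepW : {N t : ℕ} → (ℕ → ℕ → Carrier) → Vec (Vec ℕ N) (suc t) → Carrier
  stepW w (y ∷ []) = 1#
  stepW {N} w (y ∷ y' ∷ ys) =
    prodOver (allFin N) (λ j → w (lookup y j) (lookup y' j)) * stepW w (y' ∷ ys)

  headV : {A : Set} {n : ℕ} → Vec A (suc n) → A
  headV (x ∷ _) = x

  lastV : {A : Set} {n : ℕ} → Vec A (suc n) → A
  lastV (x ∷ []) = x
  lastV (x ∷ y ∷ ys) = lastV (y ∷ ys)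

  Z : (L N : ℕ) → (ℕ → ℕ → Carrier) → (ℕ → Carrier) → (t : ℕ) →
      Vec ℕ N → Vec ℕ N → Carrier
  Z L N w v t a b =
    sumOver (allVecs (configs N L) (suc t)) (λ fam →
      δ (eqVec (headV fam) a ∧ eqVec (lastV fam) b ∧ stepsOK fam)
        * (Vw v (headV fam) * stepW w fam))

  Edet : {K N : ℕ} → (Fin K → ℕ → Carrier) → Vec (Fin K) N → Vec ℕ N → Carrier
  Edet {K} {N} C k y =
    sumOver (perms N) (λ σ →
      sgn σ * prodOver (allFin N) (λ α → C (lookup k (lookup σ α)) (lookup y α)))

  Lam : {K N : ℕ} → (Fin K → Carrier) → Vec (Fin K) N → Carrier
  Lam {K} {N} λk k = prodOver (allFin N) (λ α → λk (lookup k α))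

  -- spectral data of the hypothesis, with 𝒦_1 = Fin K
  record Spectral (cj : Conj) (L : ℕ) (w : ℕ → ℕ → Carrier) (K : ℕ) : Set (c ⊔ ℓ) where
    open Conj cj
    field
      lam : Fin K → Carrier
      Rv  : Par → Fin K → ℕ → Carrier
      Lv  : Par → Fin K → ℕ → Carrier
      R-indep : ∀ p (a : Fin K → Carrier) →
        (∀ y → InS p L y → sumOver (allFin K) (λ k → a k * Rv p k y) ≈ 0#) →
        ∀ k → a k ≈ 0#
      R-span : ∀ p (u : ℕ → Carrier) → ∃ λ (a : Fin K → Carrier) →
        ∀ y → InS p L y → u y ≈ sumOver (allFin K) (λ k → a k * Rv p k y)
      -- (1) T^{eo}_1 R^o_k = λ_k R^e_k  (p = e),  T^{oe}_1 R^e_k = λ_k R^o_k  (p = o)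
      R-eig : ∀ p k y → InS p L y →
        sumOver (sites (flipP p) L) (λ y' → Tent w y y' * Rv (flipP p) k y') ≈ lam k * Rv p k y
      biorth : ∀ p k k' →
        sumOver (sites p L) (λ y → conj (Lv p k y) * Rv p k' y) ≈ δ (toℕ k ≡ᵇ toℕ k')
      complete : ∀ p y y' → InS p L y → InS p L y' →
        sumOver (allFin K) (λ k → Rv p k y * conj (Lv p k y')) ≈ δ (y ≡ᵇ y')
      -- (3) L^o_k T^{oe}_1 = λ_k L^e_k  (p = o),  L^e_k T^{eo}_1 = λ_k L^o_k  (p = e)
      L-eig : ∀ p k y → InS (flipP p) L y →
        sumOver (sites p L) (λ y' → Lv p k y' * Tent w y' y) ≈ lam k * Lv (flipP p) k y

module Submission where

-- Write Z_t(a → b) = V(a) · P_t(a, b), where P_t(a, b) is the total weight of the non-intersecting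
-- path families from a to b.  One time step acts diagonally on the Slater determinants E^q_{R,k}:
-- moving increasing same-parity positions by ±1 can only create collisions of neighbours, where the
-- determinant vanishes, so the sum over the new non-intersecting configurations extends to all of
-- (S^q_L)^N and factorises into the one-particle equations T R_k = λ_k R_k.  Hence P_t is obtained from
-- P_0 by multiplying each term by Λ_k^t, and P_0(c, b) = Σ_k E_{R,k}(c) conj(E_{L,k}(b)) = δ(c, b):
-- by Cauchy–Binet the sum is det (Σ_j R_j(c_α) conj(L_j(b_β))), which is det (δ(c_α, b_β)) by
-- completeness of the one-particle basis.

open import Defs
import Level
open import Algebra.Bundles using (CommutativeRing)
open import Data.Nat as ℕ using (ℕ; zero; suc; _≤_; _<_; z≤n; s≤s; _≡ᵇ_; _<ᵇ_; _≤ᵇ_; ∣_-_∣)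
import Data.Nat.Properties as ℕP
open import Data.Bool using (Bool; true; false; _∧_; not; T; if_then_else_)
import Data.Bool.Properties as BoolP
open import Data.Bool.ListAction using () renaming (all to allᵇ)
open import Data.List using (List; []; _∷_; _++_; map; concatMap; upTo; allFin; filterᵇ)
import Data.List.Properties as ListP
open import Data.List.Membership.Propositional using (_∈_)
open import Data.List.Membership.Propositional.Properties using (∈-allFin; ∈-upTo⁻)
open import Data.List.Relation.Unary.Any using (here; there)
open import Data.Vec as Vec using (Vec; []; _∷_; lookup; removeAt)
import Data.Vec.Properties as VecP
open import Data.Fin as Fin using (Fin; toℕ; punchIn)
import Data.Fin.Properties as FinP
open import Data.Fin.Permutation as Permutation using (Permutation′)
open import Data.Product using (∃; _×_; _,_; proj₁; proj₂)
open import Data.Sum using (_⊎_; inj₁; inj₂)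
open import Data.Empty using (⊥-elim)
open import Data.Unit using (⊤; tt)
open import Function using (_∘_; id; Equivalence)
open import Relation.Nullary using (yes; no)
open import Relation.Binary.PropositionalEquality as P using (_≡_; _≢_)

module ListSums {c ℓ} (R : CommutativeRing c ℓ) where
  open CommutativeRing R
  open import Relation.Binary.Reasoning.Setoid setoid
  open import Algebra.Properties.Ring ring public
    using (-0#≈0#; -‿involutive; -‿+-comm; -‿distribˡ-*; -‿distribʳ-*; -1*x≈-x; x+x≈x⇒x≈0; +-inverseʳ-unique)
  open import Algebra.Properties.CommutativeSemigroup *-commutativeSemigroup public
    using () renaming (interchange to *-interchange; x∙yz≈y∙xz to x*yz≈y*xz)
  open import Algebra.Properties.CommutativeSemigroup +-commutativeSemigroup
    using () renaming (interchange to +-interchange)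

  ∑ : {A : Set} → List A → (A → Carrier) → Carrier
  ∑ = sumOver R

  ∏ : {A : Set} → List A → (A → Carrier) → Carrier
  ∏ = prodOver R

  𝟙 : Bool → Carrier
  𝟙 = δ R

  𝟙-true : ∀ {b} → b ≡ true → 𝟙 b ≈ 1#
  𝟙-true P.refl = refl

  𝟙-false : ∀ {b} → b ≡ false → 𝟙 b ≈ 0#
  𝟙-false P.refl = refl

  both-zero : ∀ {x y} → x ≈ 0# → y ≈ 0# → x ≈ y
  both-zero x≈0 y≈0 = trans x≈0 (sym y≈0)

  *-≈0ˡ : ∀ {x} y → x ≈ 0# → x * y ≈ 0#
  *-≈0ˡ y x≈0 = trans (*-congʳ x≈0) (zeroˡ y)

  *-≈0ʳ : ∀ x {y} → y ≈ 0# → x * y ≈ 0#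
  *-≈0ʳ x y≈0 = trans (*-congˡ y≈0) (zeroʳ x)

  𝟙-∧ : ∀ a b → 𝟙 (a ∧ b) ≈ 𝟙 a * 𝟙 b
  𝟙-∧ false b = sym (zeroˡ _)
  𝟙-∧ true b = sym (*-identityˡ _)

  module _ {A : Set} where

    ∑-cong : ∀ (xs : List A) {f g : A → Carrier} → (∀ x → f x ≈ g x) → ∑ xs f ≈ ∑ xs g
    ∑-cong [] f≈g = refl
    ∑-cong (x ∷ xs) f≈g = +-cong (f≈g x) (∑-cong xs f≈g)

    ∑-cong-∈ : ∀ (xs : List A) {f g : A → Carrier} → (∀ x → x ∈ xs → f x ≈ g x) → ∑ xs f ≈ ∑ xs g
    ∑-cong-∈ [] f≈g = refl
    ∑-cong-∈ (x ∷ xs) f≈g = +-cong (f≈g x (here P.refl)) (∑-cong-∈ xs (λ y y∈xs → f≈g y (there y∈xs)))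

    ∏-cong : ∀ (xs : List A) {f g : A → Carrier} → (∀ x → f x ≈ g x) → ∏ xs f ≈ ∏ xs g
    ∏-cong [] f≈g = refl
    ∏-cong (x ∷ xs) f≈g = *-cong (f≈g x) (∏-cong xs f≈g)

    ∑-zero : ∀ (xs : List A) {f : A → Carrier} → (∀ x → f x ≈ 0#) → ∑ xs f ≈ 0#
    ∑-zero [] f≈0 = refl
    ∑-zero (x ∷ xs) f≈0 = trans (+-cong (f≈0 x) (∑-zero xs f≈0)) (+-identityˡ 0#)

    ∏-one : ∀ (xs : List A) {f : A → Carrier} → (∀ x → f x ≈ 1#) → ∏ xs f ≈ 1#
    ∏-one [] f≈1 = refl
    ∏-one (x ∷ xs) f≈1 = trans (*-cong (f≈1 x) (∏-one xs f≈1)) (*-identityˡ 1#)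

    ∑-distrib-+ : ∀ (xs : List A) (f g : A → Carrier) → ∑ xs (λ x → f x + g x) ≈ ∑ xs f + ∑ xs g
    ∑-distrib-+ [] f g = sym (+-identityˡ 0#)
    ∑-distrib-+ (x ∷ xs) f g = trans (+-congˡ (∑-distrib-+ xs f g)) (+-interchange _ _ _ _)

    ∏-distrib-* : ∀ (xs : List A) (f g : A → Carrier) → ∏ xs (λ x → f x * g x) ≈ ∏ xs f * ∏ xs g
    ∏-distrib-* [] f g = sym (*-identityˡ 1#)
    ∏-distrib-* (x ∷ xs) f g = trans (*-congˡ (∏-distrib-* xs f g)) (*-interchange _ _ _ _)

    *-distribˡ-∑ : ∀ (xs : List A) a (f : A → Carrier) → a * ∑ xs f ≈ ∑ xs (λ x → a * f x)
    *-distribˡ-∑ [] a f = zeroʳ a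
    *-distribˡ-∑ (x ∷ xs) a f = trans (distribˡ _ _ _) (+-congˡ (*-distribˡ-∑ xs a f))

    *-distribʳ-∑ : ∀ (xs : List A) a (f : A → Carrier) → ∑ xs f * a ≈ ∑ xs (λ x → f x * a)
    *-distribʳ-∑ [] a f = zeroˡ a
    *-distribʳ-∑ (x ∷ xs) a f = trans (distribʳ _ _ _) (+-congˡ (*-distribʳ-∑ xs a f))

    -‿∑ : ∀ (xs : List A) (f : A → Carrier) → - ∑ xs f ≈ ∑ xs (λ x → - f x)
    -‿∑ [] f = -0#≈0#
    -‿∑ (x ∷ xs) f = trans (sym (-‿+-comm _ _)) (+-congˡ (-‿∑ xs f))

    ∑-++ : ∀ (xs ys : List A) (f : A → Carrier) → ∑ (xs ++ ys) f ≈ ∑ xs f + ∑ ys f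
    ∑-++ [] ys f = sym (+-identityˡ _)
    ∑-++ (x ∷ xs) ys f = trans (+-congˡ (∑-++ xs ys f)) (sym (+-assoc _ _ _))

    ∑-filterᵇ : ∀ (p : A → Bool) (xs : List A) (f : A → Carrier) →
      ∑ (filterᵇ p xs) f ≈ ∑ xs (λ x → 𝟙 (p x) * f x)
    ∑-filterᵇ p [] f = refl
    ∑-filterᵇ p (x ∷ xs) f with p x
    ... | true = +-cong (sym (*-identityˡ _)) (∑-filterᵇ p xs f)
    ... | false = trans (∑-filterᵇ p xs f) (sym (trans (+-congʳ (zeroˡ _)) (+-identityˡ _)))

  ∑-map : ∀ {A B : Set} (g : A → B) (xs : List A) (f : B → Carrier) → ∑ (map g xs) f ≡ ∑ xs (f ∘ g)
  ∑-map g [] f = P.refl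
  ∑-map g (x ∷ xs) f = P.cong (f (g x) +_) (∑-map g xs f)

  ∏-map : ∀ {A B : Set} (g : A → B) (xs : List A) (f : B → Carrier) → ∏ (map g xs) f ≡ ∏ xs (f ∘ g)
  ∏-map g [] f = P.refl
  ∏-map g (x ∷ xs) f = P.cong (f (g x) *_) (∏-map g xs f)

  ∏-𝟙 : ∀ {A : Set} (xs : List A) (f : A → Bool) → ∏ xs (𝟙 ∘ f) ≈ 𝟙 (allᵇ f xs)
  ∏-𝟙 [] f = refl
  ∏-𝟙 (x ∷ xs) f = trans (*-congˡ (∏-𝟙 xs f)) (sym (𝟙-∧ _ _))

  ∑-concatMap : ∀ {A B : Set} (g : A → List B) (xs : List A) (f : B → Carrier) →
    ∑ (concatMap g xs) f ≈ ∑ xs (λ x → ∑ (g x) f)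
  ∑-concatMap g [] f = refl
  ∑-concatMap g (x ∷ xs) f = trans (∑-++ (g x) _ f) (+-congˡ (∑-concatMap g xs f))

  ∑-comm : ∀ {A B : Set} (xs : List A) (ys : List B) (f : A → B → Carrier) →
    ∑ xs (λ x → ∑ ys (f x)) ≈ ∑ ys (λ y → ∑ xs (λ x → f x y))
  ∑-comm [] ys f = sym (∑-zero ys (λ _ → refl))
  ∑-comm (x ∷ xs) ys f = trans (+-congˡ (∑-comm xs ys f)) (sym (∑-distrib-+ ys _ _))

  ∏-comm : ∀ {A B : Set} (xs : List A) (ys : List B) (f : A → B → Carrier) →
    ∏ xs (λ x → ∏ ys (f x)) ≈ ∏ ys (λ y → ∏ xs (λ x → f x y))
  ∏-comm [] ys f = sym (∏-one ys (λ _ → refl))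
  ∏-comm (x ∷ xs) ys f = trans (*-congˡ (∏-comm xs ys f)) (sym (∏-distrib-* ys _ _))

  ∑-allFin-suc : ∀ n (f : Fin (suc n) → Carrier) →
    ∑ (allFin (suc n)) f ≡ f Fin.zero + ∑ (allFin n) (f ∘ Fin.suc)
  ∑-allFin-suc n f = P.cong (f Fin.zero +_)
    (P.trans (P.cong (λ xs → ∑ xs f) (P.sym (ListP.map-tabulate id Fin.suc))) (∑-map Fin.suc (allFin n) f))

  ∏-allFin-suc : ∀ n (f : Fin (suc n) → Carrier) →
    ∏ (allFin (suc n)) f ≡ f Fin.zero * ∏ (allFin n) (f ∘ Fin.suc)
  ∏-allFin-suc n f = P.cong (f Fin.zero *_)
    (P.trans (P.cong (λ xs → ∏ xs f) (P.sym (ListP.map-tabulate id Fin.suc))) (∏-map Fin.suc (allFin n) f))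

  ∑-upTo-suc : ∀ n (f : ℕ → Carrier) → ∑ (upTo (suc n)) f ≡ f 0 + ∑ (upTo n) (f ∘ suc)
  ∑-upTo-suc n f = P.cong (f 0 +_)
    (P.trans (P.cong (λ xs → ∑ xs f) (P.sym (ListP.map-upTo suc n))) (∑-map suc (upTo n) f))

  ∑-𝟙-upTo : ∀ n y (f : ℕ → Carrier) → y < n → ∑ (upTo n) (λ x → 𝟙 (x ≡ᵇ y) * f x) ≈ f y
  ∑-𝟙-upTo (suc n) zero f _ = begin
    ∑ (upTo (suc n)) (λ x → 𝟙 (x ≡ᵇ 0) * f x) ≡⟨ ∑-upTo-suc n _ ⟩
    1# * f 0 + ∑ (upTo n) (λ x → 0# * f (suc x)) ≈⟨ +-cong (*-identityˡ _) (∑-zero (upTo n) (λ _ → zeroˡ _)) ⟩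
    f 0 + 0#                                       ≈⟨ +-identityʳ _ ⟩
    f 0                                            ∎
  ∑-𝟙-upTo (suc n) (suc y) f (s≤s y<n) = begin
    ∑ (upTo (suc n)) (λ x → 𝟙 (x ≡ᵇ suc y) * f x)           ≡⟨ ∑-upTo-suc n _ ⟩
    0# * f 0 + ∑ (upTo n) (λ x → 𝟙 (x ≡ᵇ y) * f (suc x)) ≈⟨ +-cong (zeroˡ _) (∑-𝟙-upTo n y (f ∘ suc) y<n) ⟩
    0# + f (suc y)                                          ≈⟨ +-identityˡ _ ⟩
    f (suc y)                                               ∎

  ∑-𝟙-allFin : ∀ n (y : Fin n) (f : Fin n → Carrier) → ∑ (allFin n) (λ x → 𝟙 (toℕ x ≡ᵇ toℕ y) * f x) ≈ f y
  ∑-𝟙-allFin (suc n) Fin.zero f = begin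
    ∑ (allFin (suc n)) (λ x → 𝟙 (toℕ x ≡ᵇ 0) * f x)
      ≡⟨ ∑-allFin-suc n _ ⟩
    1# * f Fin.zero + ∑ (allFin n) (λ x → 0# * f (Fin.suc x))
      ≈⟨ +-cong (*-identityˡ _) (∑-zero (allFin n) (λ _ → zeroˡ _)) ⟩
    f Fin.zero + 0#
      ≈⟨ +-identityʳ _ ⟩
    f Fin.zero ∎
  ∑-𝟙-allFin (suc n) (Fin.suc y) f = begin
    ∑ (allFin (suc n)) (λ x → 𝟙 (toℕ x ≡ᵇ suc (toℕ y)) * f x)
      ≡⟨ ∑-allFin-suc n _ ⟩
    0# * f Fin.zero + ∑ (allFin n) (λ x → 𝟙 (toℕ x ≡ᵇ toℕ y) * f (Fin.suc x))
      ≈⟨ +-cong (zeroˡ _) (∑-𝟙-allFin n y (f ∘ Fin.suc)) ⟩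
    0# + f (Fin.suc y)
      ≈⟨ +-identityˡ _ ⟩
    f (Fin.suc y) ∎

true-or-false : ∀ b → b ≡ true ⊎ b ≡ false
true-or-false true = inj₁ P.refl
true-or-false false = inj₂ P.refl

swapAt : ∀ {A : Set} {n} → Fin n → Vec A (suc n) → Vec A (suc n)
swapAt Fin.zero (x ∷ y ∷ v) = y ∷ x ∷ v
swapAt (Fin.suc a) (x ∷ v) = x ∷ swapAt a v

RepeatsAt : ∀ {A : Set} {n} → Fin n → Vec A (suc n) → Set
RepeatsAt Fin.zero (x ∷ y ∷ v) = x ≡ y
RepeatsAt (Fin.suc a) (x ∷ v) = RepeatsAt a v

swapAt-repeats : ∀ {A : Set} {n} (a : Fin n) (v : Vec A (suc n)) → RepeatsAt a v → swapAt a v ≡ v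
swapAt-repeats Fin.zero (x ∷ y ∷ v) P.refl = P.refl
swapAt-repeats (Fin.suc a) (x ∷ v) r = P.cong (x ∷_) (swapAt-repeats a v r)

eqVecBy : ∀ {A : Set} {n} → (A → A → Bool) → Vec A n → Vec A n → Bool
eqVecBy _==_ [] [] = true
eqVecBy _==_ (x ∷ u) (y ∷ v) = (x == y) ∧ eqVecBy _==_ u v

eqVecBy⇒≡ : ∀ {A : Set} {n} {_==_ : A → A → Bool} → (∀ x y → (x == y) ≡ true → x ≡ y) →
  ∀ (u v : Vec A n) → eqVecBy _==_ u v ≡ true → u ≡ v
eqVecBy⇒≡ sound [] [] _ = P.refl
eqVecBy⇒≡ {_==_ = _==_} sound (x ∷ u) (y ∷ v) eq with x == y in x=y
... | true = P.cong₂ _∷_ (sound x y x=y) (eqVecBy⇒≡ sound u v eq)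

eqVecBy-refl : ∀ {A : Set} {n} {_==_ : A → A → Bool} → (∀ x → (x == x) ≡ true) →
  ∀ (u : Vec A n) → eqVecBy _==_ u u ≡ true
eqVecBy-refl refl== [] = P.refl
eqVecBy-refl refl== (x ∷ u) rewrite refl== x = eqVecBy-refl refl== u

module VecSums {c ℓ} (R : CommutativeRing c ℓ) where
  open CommutativeRing R
  open ListSums R
  open import Relation.Binary.Reasoning.Setoid setoid

  zipProd : ∀ {A B : Set} {n} → (A → B → Carrier) → Vec A n → Vec B n → Carrier
  zipProd H [] [] = 1#
  zipProd H (x ∷ u) (y ∷ v) = H x y * zipProd H u v

  entryProd : ∀ {A : Set} {n} → (A → Carrier) → Vec A n → Carrier
  entryProd w [] = 1#
  entryProd w (x ∷ v) = w x * entryProd w v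

  zipProd≈∏ : ∀ {A B : Set} {n} (H : A → B → Carrier) (u : Vec A n) (v : Vec B n) →
    ∏ (allFin n) (λ α → H (lookup u α) (lookup v α)) ≈ zipProd H u v
  zipProd≈∏ H [] [] = refl
  zipProd≈∏ {n = suc n} H (x ∷ u) (y ∷ v) = trans (reflexive (∏-allFin-suc n _)) (*-congˡ (zipProd≈∏ H u v))

  entryProd≈∏ : ∀ {A : Set} {n} (w : A → Carrier) (v : Vec A n) → entryProd w v ≈ ∏ (allFin n) (w ∘ lookup v)
  entryProd≈∏ w [] = refl
  entryProd≈∏ {n = suc n} w (x ∷ v) = trans (*-congˡ (entryProd≈∏ w v)) (reflexive (P.sym (∏-allFin-suc n _)))

  entryProd-map : ∀ {A B : Set} {n} (w : B → Carrier) (g : A → B) (v : Vec A n) →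
    entryProd w (Vec.map g v) ≡ entryProd (w ∘ g) v
  entryProd-map w g [] = P.refl
  entryProd-map w g (x ∷ v) = P.cong (w (g x) *_) (entryProd-map w g v)

  zipProd-swapAt : ∀ {A B : Set} {n} (H : A → B → Carrier) (a : Fin n) (u : Vec A (suc n)) (v : Vec B (suc n)) →
    zipProd H (swapAt a u) (swapAt a v) ≈ zipProd H u v
  zipProd-swapAt H Fin.zero (x ∷ y ∷ u) (x' ∷ y' ∷ v) = x*yz≈y*xz _ _ _
  zipProd-swapAt H (Fin.suc a) (x ∷ u) (x' ∷ v) = *-congˡ (zipProd-swapAt H a u v)

  zipProd-mapˡ : ∀ {A A' B : Set} {n} (g : A → A') (H : A' → B → Carrier) (u : Vec A n) (v : Vec B n) →
    zipProd (H ∘ g) u v ≡ zipProd H (Vec.map g u) v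
  zipProd-mapˡ g H [] [] = P.refl
  zipProd-mapˡ g H (x ∷ u) (y ∷ v) = P.cong (H (g x) y *_) (zipProd-mapˡ g H u v)

  zipProd-≡ᵇ : ∀ {n} (u v : Vec ℕ n) → zipProd (λ x y → 𝟙 (x ≡ᵇ y)) u v ≈ 𝟙 (eqVec u v)
  zipProd-≡ᵇ [] [] = refl
  zipProd-≡ᵇ (x ∷ u) (y ∷ v) = trans (*-congˡ (zipProd-≡ᵇ u v)) (sym (𝟙-∧ _ _))

  module _ {A : Set} (xs : List A) where

    ∑-allVecs-suc : ∀ n (F : Vec A (suc n) → Carrier) →
      ∑ (allVecs xs (suc n)) F ≈ ∑ xs (λ x → ∑ (allVecs xs n) (F ∘ (x ∷_)))
    ∑-allVecs-suc n F = trans (∑-concatMap _ xs F) (∑-cong xs (λ x → reflexive (∑-map (x ∷_) (allVecs xs n) F)))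

    ∑-allVecs-cong-∈ : ∀ n {F G : Vec A n → Carrier} →
      (∀ v → (∀ α → lookup v α ∈ xs) → F v ≈ G v) → ∑ (allVecs xs n) F ≈ ∑ (allVecs xs n) G
    ∑-allVecs-cong-∈ zero F≈G = +-congʳ (F≈G [] (λ ()))
    ∑-allVecs-cong-∈ (suc n) {F} {G} F≈G = begin
      ∑ (allVecs xs (suc n)) F                        ≈⟨ ∑-allVecs-suc n F ⟩
      ∑ xs (λ x → ∑ (allVecs xs n) (F ∘ (x ∷_)))   ≈⟨ ∑-cong-∈ xs (λ x x∈ → ∑-allVecs-cong-∈ n (λ v v∈ →
                                                            F≈G (x ∷ v) (λ { Fin.zero → x∈ ; (Fin.suc α) → v∈ α }))) ⟩
      ∑ xs (λ x → ∑ (allVecs xs n) (G ∘ (x ∷_)))   ≈⟨ ∑-allVecs-suc n G ⟨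
      ∑ (allVecs xs (suc n)) G                        ∎

    ∑∏≈∏∑ : ∀ n (g : Fin n → A → Carrier) →
      ∑ (allVecs xs n) (λ v → ∏ (allFin n) (λ α → g α (lookup v α))) ≈ ∏ (allFin n) (λ α → ∑ xs (g α))
    ∑∏≈∏∑ zero g = +-identityʳ _
    ∑∏≈∏∑ (suc n) g = begin
      ∑ (allVecs xs (suc n)) (λ v → ∏ (allFin (suc n)) (λ α → g α (lookup v α)))
        ≈⟨ ∑-allVecs-suc n _ ⟩
      ∑ xs (λ x → ∑ (allVecs xs n) (λ v → ∏ (allFin (suc n)) (λ α → g α (lookup (x ∷ v) α))))
        ≈⟨ ∑-cong xs (λ x → ∑-cong (allVecs xs n) (λ v → reflexive (∏-allFin-suc n _))) ⟩
      ∑ xs (λ x → ∑ (allVecs xs n) (λ v → g Fin.zero x * ∏ (allFin n) (λ α → g (Fin.suc α) (lookup v α))))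
        ≈⟨ ∑-cong xs (λ x → *-distribˡ-∑ (allVecs xs n) _ _) ⟨
      ∑ xs (λ x → g Fin.zero x * ∑ (allVecs xs n) (λ v → ∏ (allFin n) (λ α → g (Fin.suc α) (lookup v α))))
        ≈⟨ ∑-cong xs (λ x → *-congˡ (∑∏≈∏∑ n (g ∘ Fin.suc))) ⟩
      ∑ xs (λ x → g Fin.zero x * ∏ (allFin n) (λ α → ∑ xs (g (Fin.suc α))))
        ≈⟨ *-distribʳ-∑ xs _ _ ⟨
      ∑ xs (g Fin.zero) * ∏ (allFin n) (λ α → ∑ xs (g (Fin.suc α)))
        ≡⟨ ∏-allFin-suc n _ ⟨
      ∏ (allFin (suc n)) (λ α → ∑ xs (g α)) ∎

    ∑-allVecs-𝟙-eq : (_==_ : A → A → Bool) → ∀ n (u : Vec A n) →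
      (∀ α (f : A → Carrier) → ∑ xs (λ x → 𝟙 (x == lookup u α) * f x) ≈ f (lookup u α)) →
      ∀ (F : Vec A n → Carrier) → ∑ (allVecs xs n) (λ v → 𝟙 (eqVecBy _==_ v u) * F v) ≈ F u
    ∑-allVecs-𝟙-eq _==_ zero [] _ F = trans (+-identityʳ _) (*-identityˡ _)
    ∑-allVecs-𝟙-eq _==_ (suc n) (y ∷ u) collapse F = begin
      ∑ (allVecs xs (suc n)) (λ v → 𝟙 (eqVecBy _==_ v (y ∷ u)) * F v)
        ≈⟨ ∑-allVecs-suc n _ ⟩
      ∑ xs (λ x → ∑ (allVecs xs n) (λ v → 𝟙 ((x == y) ∧ eqVecBy _==_ v u) * F (x ∷ v)))
        ≈⟨ ∑-cong xs (λ x → ∑-cong (allVecs xs n) (λ v → trans (*-congʳ (𝟙-∧ _ _)) (*-assoc _ _ _))) ⟩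
      ∑ xs (λ x → ∑ (allVecs xs n) (λ v → 𝟙 (x == y) * (𝟙 (eqVecBy _==_ v u) * F (x ∷ v))))
        ≈⟨ ∑-cong xs (λ x → *-distribˡ-∑ (allVecs xs n) _ _) ⟨
      ∑ xs (λ x → 𝟙 (x == y) * ∑ (allVecs xs n) (λ v → 𝟙 (eqVecBy _==_ v u) * F (x ∷ v)))
        ≈⟨ ∑-cong xs (λ x → *-congˡ (∑-allVecs-𝟙-eq _==_ n u (collapse ∘ Fin.suc) (F ∘ (x ∷_)))) ⟩
      ∑ xs (λ x → 𝟙 (x == y) * F (x ∷ u))
        ≈⟨ collapse Fin.zero (λ x → F (x ∷ u)) ⟩
      F (y ∷ u) ∎

    ∑-allVecs-swapAt : ∀ {n} (a : Fin n) (F : Vec A (suc n) → Carrier) →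
      ∑ (allVecs xs (suc n)) (F ∘ swapAt a) ≈ ∑ (allVecs xs (suc n)) F
    ∑-allVecs-swapAt {suc n} Fin.zero F = begin
      ∑ (allVecs xs (suc (suc n))) (F ∘ swapAt Fin.zero)              ≈⟨ ∑-allVecs-suc (suc n) _ ⟩
      ∑ xs (λ x → ∑ (allVecs xs (suc n)) (F ∘ swapAt Fin.zero ∘ (x ∷_))) ≈⟨ ∑-cong xs (λ x → ∑-allVecs-suc n _) ⟩
      ∑ xs (λ x → ∑ xs (λ y → ∑ (allVecs xs n) (λ v → F (y ∷ x ∷ v))))  ≈⟨ ∑-comm xs xs _ ⟩
      ∑ xs (λ y → ∑ xs (λ x → ∑ (allVecs xs n) (λ v → F (y ∷ x ∷ v))))  ≈⟨ ∑-cong xs (λ y → ∑-allVecs-suc n _) ⟨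
      ∑ xs (λ y → ∑ (allVecs xs (suc n)) (F ∘ (y ∷_)))                 ≈⟨ ∑-allVecs-suc (suc n) _ ⟨
      ∑ (allVecs xs (suc (suc n))) F                                    ∎
    ∑-allVecs-swapAt {suc n} (Fin.suc a) F = begin
      ∑ (allVecs xs (suc (suc n))) (F ∘ swapAt (Fin.suc a))          ≈⟨ ∑-allVecs-suc (suc n) _ ⟩
      ∑ xs (λ x → ∑ (allVecs xs (suc n)) (F ∘ (x ∷_) ∘ swapAt a))     ≈⟨ ∑-cong xs (λ x → ∑-allVecs-swapAt a (F ∘ (x ∷_))) ⟩
      ∑ xs (λ x → ∑ (allVecs xs (suc n)) (F ∘ (x ∷_)))                ≈⟨ ∑-allVecs-suc (suc n) _ ⟨
      ∑ (allVecs xs (suc (suc n))) F                                   ∎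

    ∑∑-antisymmetric : (H : A → A → Carrier) → (∀ x → H x x ≈ 0#) → (∀ x y → H y x ≈ - H x y) →
      ∑ xs (λ x → ∑ xs (H x)) ≈ 0#
    ∑∑-antisymmetric H diag anti = go xs
      where
      go : (ys : List A) → ∑ ys (λ x → ∑ ys (H x)) ≈ 0#
      go [] = refl
      go (z ∷ ys) = begin
        (H z z + ∑ ys (H z)) + ∑ ys (λ x → H x z + ∑ ys (H x))
          ≈⟨ +-cong (trans (+-congʳ (diag z)) (+-identityˡ _)) (∑-distrib-+ ys _ _) ⟩
        ∑ ys (H z) + (∑ ys (λ x → H x z) + ∑ ys (λ x → ∑ ys (H x)))
          ≈⟨ +-assoc _ _ _ ⟨
        (∑ ys (H z) + ∑ ys (λ x → H x z)) + ∑ ys (λ x → ∑ ys (H x))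
          ≈⟨ +-cong (sym (∑-distrib-+ ys _ _)) (go ys) ⟩
        ∑ ys (λ x → H z x + H x z) + 0#
          ≈⟨ +-identityʳ _ ⟩
        ∑ ys (λ x → H z x + H x z)
          ≈⟨ ∑-zero ys (λ x → trans (+-congˡ (anti z x)) (-‿inverseʳ _)) ⟩
        0# ∎

    ∑-allVecs-antisymmetric : ∀ {n} (a : Fin n) (T : Vec A (suc n) → Carrier) →
      (∀ v → T (swapAt a v) ≈ - T v) → (∀ v → RepeatsAt a v → T v ≈ 0#) → ∑ (allVecs xs (suc n)) T ≈ 0#
    ∑-allVecs-antisymmetric {suc n} Fin.zero T anti rep = begin
      ∑ (allVecs xs (suc (suc n))) T                                 ≈⟨ ∑-allVecs-suc (suc n) _ ⟩
      ∑ xs (λ x → ∑ (allVecs xs (suc n)) (T ∘ (x ∷_)))              ≈⟨ ∑-cong xs (λ x → ∑-allVecs-suc n _) ⟩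
      ∑ xs (λ x → ∑ xs (λ y → ∑ (allVecs xs n) (λ v → T (x ∷ y ∷ v)))) ≈⟨ ∑∑-antisymmetric _
           (λ x → ∑-zero (allVecs xs n) (λ v → rep (x ∷ x ∷ v) P.refl))
           (λ x y → trans (∑-cong (allVecs xs n) (λ v → anti (x ∷ y ∷ v))) (sym (-‿∑ (allVecs xs n) _))) ⟩
      0#                                                              ∎
    ∑-allVecs-antisymmetric {suc n} (Fin.suc a) T anti rep = begin
      ∑ (allVecs xs (suc (suc n))) T                    ≈⟨ ∑-allVecs-suc (suc n) _ ⟩
      ∑ xs (λ x → ∑ (allVecs xs (suc n)) (T ∘ (x ∷_))) ≈⟨ ∑-zero xs (λ x → ∑-allVecs-antisymmetric a (T ∘ (x ∷_))
                                                             (λ v → anti (x ∷ v)) (λ v → rep (x ∷ v))) ⟩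
      0#                                                 ∎

  ∑-allVecs-weighted-map : ∀ {A B : Set} (xs : List A) (ys : List B) (φ : B → A) (w : A → Carrier) →
    (∀ f → ∑ xs (λ x → w x * f x) ≈ ∑ ys (f ∘ φ)) →
    ∀ n (F : Vec A n → Carrier) → ∑ (allVecs xs n) (λ v → entryProd w v * F v) ≈ ∑ (allVecs ys n) (F ∘ Vec.map φ)
  ∑-allVecs-weighted-map xs ys φ w reindex zero F = +-congʳ (*-identityˡ _)
  ∑-allVecs-weighted-map xs ys φ w reindex (suc n) F = begin
    ∑ (allVecs xs (suc n)) (λ v → entryProd w v * F v)
      ≈⟨ ∑-allVecs-suc xs n _ ⟩
    ∑ xs (λ x → ∑ (allVecs xs n) (λ v → (w x * entryProd w v) * F (x ∷ v)))
      ≈⟨ ∑-cong xs (λ x → trans (∑-cong (allVecs xs n) (λ v → *-assoc _ _ _)) (sym (*-distribˡ-∑ (allVecs xs n) _ _))) ⟩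
    ∑ xs (λ x → w x * ∑ (allVecs xs n) (λ v → entryProd w v * F (x ∷ v)))
      ≈⟨ ∑-cong xs (λ x → *-congˡ (∑-allVecs-weighted-map xs ys φ w reindex n (F ∘ (x ∷_)))) ⟩
    ∑ xs (λ x → w x * ∑ (allVecs ys n) (λ u → F (x ∷ Vec.map φ u)))
      ≈⟨ reindex _ ⟩
    ∑ ys (λ y → ∑ (allVecs ys n) (λ u → F (φ y ∷ Vec.map φ u)))
      ≈⟨ ∑-allVecs-suc ys n _ ⟨
    ∑ (allVecs ys (suc n)) (F ∘ Vec.map φ) ∎

≡ᵇ⇒≡ : ∀ m n → (m ≡ᵇ n) ≡ true → m ≡ n
≡ᵇ⇒≡ m n eq = ℕP.≡ᵇ⇒≡ m n (Equivalence.from BoolP.T-≡ eq)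

≡ᵇ-refl : ∀ n → (n ≡ᵇ n) ≡ true
≡ᵇ-refl n = Equivalence.to BoolP.T-≡ (ℕP.≡⇒≡ᵇ n n P.refl)

toℕ-≡ᵇ⇒≡ : ∀ {n} (x y : Fin n) → (toℕ x ≡ᵇ toℕ y) ≡ true → x ≡ y
toℕ-≡ᵇ⇒≡ x y eq = FinP.toℕ-injective (≡ᵇ⇒≡ _ _ eq)

memFin-lookup : ∀ {M n} (v : Vec (Fin M) n) α → memFin (lookup v α) v ≡ true
memFin-lookup (j ∷ v) Fin.zero rewrite ≡ᵇ-refl (toℕ j) = P.refl
memFin-lookup (j ∷ v) (Fin.suc α) with toℕ (lookup v α) ≡ᵇ toℕ j
... | true = P.refl
... | false = memFin-lookup v α

memFin⇒∃ : ∀ {M n} (i : Fin M) (v : Vec (Fin M) n) → memFin i v ≡ true → ∃ λ α → lookup v α ≡ i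
memFin⇒∃ i (j ∷ v) i∈v with toℕ i ≡ᵇ toℕ j in i≡j
... | true = Fin.zero , P.sym (toℕ-≡ᵇ⇒≡ i j i≡j)
... | false with memFin⇒∃ i v i∈v
... | α , eq = Fin.suc α , eq

noDup⇒injective : ∀ {M n} (v : Vec (Fin M) n) → noDup v ≡ true → ∀ α β → lookup v α ≡ lookup v β → α ≡ β
noDup⇒injective (x ∷ v) nd Fin.zero Fin.zero eq = P.refl
noDup⇒injective (x ∷ v) nd Fin.zero (Fin.suc β) P.refl with memFin (lookup v β) v | memFin-lookup v β
noDup⇒injective (x ∷ v) () Fin.zero (Fin.suc β) P.refl | true | _
noDup⇒injective (x ∷ v) nd (Fin.suc α) Fin.zero P.refl with memFin (lookup v α) v | memFin-lookup v α
noDup⇒injective (x ∷ v) () (Fin.suc α) Fin.zero P.refl | true | _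
noDup⇒injective (x ∷ v) nd (Fin.suc α) (Fin.suc β) eq with memFin x v
noDup⇒injective (x ∷ v) () (Fin.suc α) (Fin.suc β) eq | true
... | false = P.cong Fin.suc (noDup⇒injective v nd α β eq)

injective⇒noDup : ∀ {M n} (v : Vec (Fin M) n) → (∀ α β → lookup v α ≡ lookup v β → α ≡ β) → noDup v ≡ true
injective⇒noDup [] inj = P.refl
injective⇒noDup (x ∷ v) inj with memFin x v in x∈v
... | true with memFin⇒∃ x v x∈v
...   | α , eq with inj (Fin.suc α) Fin.zero eq
...     | ()
injective⇒noDup (x ∷ v) inj | false = injective⇒noDup v (λ α β eq → FinP.suc-injective (inj (Fin.suc α) (Fin.suc β) eq))

noDup⇒surjective : ∀ {N} (σ : Vec (Fin N) N) → noDup σ ≡ true → ∀ β → ∃ λ α → lookup σ α ≡ β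
noDup⇒surjective {suc n} σ nd β with FinP.any? (λ α → lookup σ α FinP.≟ β)
... | yes hit = hit
... | no miss = ⊥-elim (ℕP.<-irrefl P.refl (FinP.injective⇒≤ {f = skipβ} skipβ-injective))
  where
  avoids : ∀ α → β ≢ lookup σ α
  avoids α eq = miss (α , P.sym eq)
  skipβ : Fin (suc n) → Fin n
  skipβ α = Fin.punchOut (avoids α)
  skipβ-injective : ∀ {α α'} → skipβ α ≡ skipβ α' → α ≡ α'
  skipβ-injective eq = noDup⇒injective σ nd _ _ (FinP.punchOut-injective (avoids _) (avoids _) eq)

-- The default β is a junk value, reached only when σ is not surjective.
preimage : ∀ {N} → Vec (Fin N) N → Fin N → Fin N
preimage σ β with FinP.any? (λ α → lookup σ α FinP.≟ β)
... | yes (α , _) = α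
... | no _ = β

lookup-preimage : ∀ {N} (σ : Vec (Fin N) N) β → (∃ λ α → lookup σ α ≡ β) → lookup σ (preimage σ β) ≡ β
lookup-preimage σ β hit with FinP.any? (λ α → lookup σ α FinP.≟ β)
... | yes (α , eq) = eq
... | no miss = ⊥-elim (miss hit)

inverse : ∀ {N} → Vec (Fin N) N → Vec (Fin N) N
inverse σ = Vec.tabulate (preimage σ)

module _ {N} (σ : Vec (Fin N) N) (nd : noDup σ ≡ true) where

  inverseʳ : ∀ β → lookup σ (lookup (inverse σ) β) ≡ β
  inverseʳ β = P.trans (P.cong (lookup σ) (VecP.lookup∘tabulate (preimage σ) β))
                       (lookup-preimage σ β (noDup⇒surjective σ nd β))

  inverseˡ : ∀ α → lookup (inverse σ) (lookup σ α) ≡ α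
  inverseˡ α = noDup⇒injective σ nd _ _ (inverseʳ (lookup σ α))

  inverse-noDup : noDup (inverse σ) ≡ true
  inverse-noDup = injective⇒noDup (inverse σ) (λ α β eq →
    P.trans (P.sym (inverseʳ α)) (P.trans (P.cong (lookup σ) eq) (inverseʳ β)))

inverse-involutive : ∀ {N} (σ : Vec (Fin N) N) → noDup σ ≡ true → inverse (inverse σ) ≡ σ
inverse-involutive σ nd = P.trans (P.sym (VecP.tabulate∘lookup (inverse (inverse σ))))
  (P.trans (VecP.tabulate-cong pointwise) (VecP.tabulate∘lookup σ))
  where
  pointwise : ∀ α → lookup (inverse (inverse σ)) α ≡ lookup σ α
  pointwise α = P.trans (P.cong (lookup (inverse (inverse σ))) (P.sym (inverseˡ σ nd α)))
                        (inverseˡ (inverse σ) (inverse-noDup σ nd) (lookup σ α))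

asPermutation : ∀ {N} (σ : Vec (Fin N) N) → noDup σ ≡ true → Permutation′ N
asPermutation σ nd = Permutation.permutation (lookup σ) (lookup (inverse σ)) (inverseʳ σ nd) (inverseˡ σ nd)

memFin-swapAt : ∀ {M n} (i : Fin M) (a : Fin n) (v : Vec (Fin M) (suc n)) → memFin i (swapAt a v) ≡ memFin i v
memFin-swapAt i Fin.zero (x ∷ y ∷ w) with toℕ i ≡ᵇ toℕ x | toℕ i ≡ᵇ toℕ y
... | true | true = P.refl
... | true | false = P.refl
... | false | true = P.refl
... | false | false = P.refl
memFin-swapAt i (Fin.suc a) (x ∷ w) rewrite memFin-swapAt i a w = P.refl

countGt-swapAt : ∀ {M n} (i : Fin M) (a : Fin n) (v : Vec (Fin M) (suc n)) → countGt i (swapAt a v) ≡ countGt i v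
countGt-swapAt i Fin.zero (x ∷ y ∷ w) with toℕ x <ᵇ toℕ i | toℕ y <ᵇ toℕ i
... | true | true = P.refl
... | true | false = P.refl
... | false | true = P.refl
... | false | false = P.refl
countGt-swapAt i (Fin.suc a) (x ∷ w) rewrite countGt-swapAt i a w = P.refl

≢⇒toℕ-≡ᵇ-false : ∀ {n} {x y : Fin n} → x ≢ y → (toℕ x ≡ᵇ toℕ y) ≡ false
≢⇒toℕ-≡ᵇ-false {x = x} {y} x≢y with toℕ x ≡ᵇ toℕ y in eq
... | true = ⊥-elim (x≢y (toℕ-≡ᵇ⇒≡ x y eq))
... | false = P.refl

noDup-swapAt : ∀ {M n} (a : Fin n) (v : Vec (Fin M) (suc n)) → noDup (swapAt a v) ≡ noDup v
noDup-swapAt Fin.zero (x ∷ y ∷ w) with x FinP.≟ y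
... | yes P.refl = P.refl
... | no x≢y rewrite ≢⇒toℕ-≡ᵇ-false x≢y | ≢⇒toℕ-≡ᵇ-false (x≢y ∘ P.sym) =
  ∧-swap (not (memFin y w)) (not (memFin x w)) (noDup w)
  where
  ∧-swap : ∀ a b c → (a ∧ (b ∧ c)) ≡ (b ∧ (a ∧ c))
  ∧-swap a b c = P.trans (P.sym (BoolP.∧-assoc a b c)) (P.trans (P.cong (_∧ c) (BoolP.∧-comm a b)) (BoolP.∧-assoc b a c))
noDup-swapAt (Fin.suc a) (x ∷ w) rewrite memFin-swapAt x a w | noDup-swapAt a w = P.refl

repeats⇒dup : ∀ {M n} (a : Fin n) (v : Vec (Fin M) (suc n)) → RepeatsAt a v → noDup v ≡ false
repeats⇒dup Fin.zero (x ∷ .x ∷ w) P.refl rewrite ≡ᵇ-refl (toℕ x) = P.refl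
repeats⇒dup (Fin.suc a) (x ∷ w) r rewrite repeats⇒dup a w r = BoolP.∧-zeroʳ _

noDup-tail : ∀ {M n} (x : Fin M) (w : Vec (Fin M) n) → noDup (x ∷ w) ≡ true → noDup w ≡ true
noDup-tail x w nd with not (memFin x w)
... | true = nd

eqFinVec : ∀ {N n} → Vec (Fin N) n → Vec (Fin N) n → Bool
eqFinVec = eqVecBy (λ x y → toℕ x ≡ᵇ toℕ y)

eqFinVec⇒≡ : ∀ {N n} (u v : Vec (Fin N) n) → eqFinVec u v ≡ true → u ≡ v
eqFinVec⇒≡ = eqVecBy⇒≡ toℕ-≡ᵇ⇒≡

eqFinVec-refl : ∀ {N n} (u : Vec (Fin N) n) → eqFinVec u u ≡ true
eqFinVec-refl = eqVecBy-refl (λ x → ≡ᵇ-refl (toℕ x))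

removeAt-punchIn : ∀ {A : Set} {n} (v : Vec A (suc n)) i j → lookup (removeAt v i) j ≡ lookup v (punchIn i j)
removeAt-punchIn (x ∷ v) Fin.zero j = P.refl
removeAt-punchIn (x ∷ y ∷ v) (Fin.suc i) Fin.zero = P.refl
removeAt-punchIn (x ∷ y ∷ v) (Fin.suc i) (Fin.suc j) = removeAt-punchIn (y ∷ v) i j

map-lookup-punchIn : ∀ {A : Set} {n m} (k : Vec A (suc n)) (i : Fin (suc n)) (τ : Vec (Fin n) m) →
  Vec.map (lookup k) (Vec.map (punchIn i) τ) ≡ Vec.map (lookup (removeAt k i)) τ
map-lookup-punchIn k i [] = P.refl
map-lookup-punchIn k i (j ∷ τ) = P.cong₂ _∷_ (P.sym (removeAt-punchIn k i j)) (map-lookup-punchIn k i τ)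

punchIn-<ᵇ : ∀ {n} (i : Fin (suc n)) (a b : Fin n) → (toℕ (punchIn i a) <ᵇ toℕ (punchIn i b)) ≡ (toℕ a <ᵇ toℕ b)
punchIn-<ᵇ Fin.zero a b = P.refl
punchIn-<ᵇ (Fin.suc i) Fin.zero Fin.zero = P.refl
punchIn-<ᵇ (Fin.suc i) Fin.zero (Fin.suc b) = P.refl
punchIn-<ᵇ (Fin.suc i) (Fin.suc a) Fin.zero = P.refl
punchIn-<ᵇ (Fin.suc i) (Fin.suc a) (Fin.suc b) = punchIn-<ᵇ i a b

punchIn-≡ᵇ : ∀ {n} (i : Fin (suc n)) (a b : Fin n) → (toℕ (punchIn i a) ≡ᵇ toℕ (punchIn i b)) ≡ (toℕ a ≡ᵇ toℕ b)
punchIn-≡ᵇ Fin.zero a b = P.refl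
punchIn-≡ᵇ (Fin.suc i) Fin.zero Fin.zero = P.refl
punchIn-≡ᵇ (Fin.suc i) Fin.zero (Fin.suc b) = P.refl
punchIn-≡ᵇ (Fin.suc i) (Fin.suc a) Fin.zero = P.refl
punchIn-≡ᵇ (Fin.suc i) (Fin.suc a) (Fin.suc b) = punchIn-≡ᵇ i a b

module OrderEmbedding {m m' : ℕ} (φ : Fin m → Fin m')
  (φ-<ᵇ : ∀ a b → (toℕ (φ a) <ᵇ toℕ (φ b)) ≡ (toℕ a <ᵇ toℕ b))
  (φ-≡ᵇ : ∀ a b → (toℕ (φ a) ≡ᵇ toℕ (φ b)) ≡ (toℕ a ≡ᵇ toℕ b)) where

  memFin-map : ∀ {n} a (v : Vec (Fin m) n) → memFin (φ a) (Vec.map φ v) ≡ memFin a v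
  memFin-map a [] = P.refl
  memFin-map a (j ∷ v) rewrite φ-≡ᵇ a j | memFin-map a v = P.refl

  noDup-map : ∀ {n} (v : Vec (Fin m) n) → noDup (Vec.map φ v) ≡ noDup v
  noDup-map [] = P.refl
  noDup-map (j ∷ v) rewrite memFin-map j v | noDup-map v = P.refl

  countGt-map : ∀ {n} a (v : Vec (Fin m) n) → countGt (φ a) (Vec.map φ v) ≡ countGt a v
  countGt-map a [] = P.refl
  countGt-map a (j ∷ v) rewrite φ-<ᵇ j a | countGt-map a v = P.refl

  inversions-map : ∀ {n} (v : Vec (Fin m) n) → inversions (Vec.map φ v) ≡ inversions v
  inversions-map [] = P.refl
  inversions-map (j ∷ v) rewrite countGt-map j v | inversions-map v = P.refl

<ᵇ-asym : ∀ a b → ((a <ᵇ b) ∧ (b <ᵇ a)) ≡ false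
<ᵇ-asym zero zero = P.refl
<ᵇ-asym zero (suc b) = P.refl
<ᵇ-asym (suc a) zero = P.refl
<ᵇ-asym (suc a) (suc b) = <ᵇ-asym a b

identity : ∀ {N} → Vec (Fin N) N
identity = Vec.tabulate id

noDup-identity : ∀ {N} → noDup (identity {N}) ≡ true
noDup-identity {N} = injective⇒noDup (identity {N}) (λ α β eq →
  P.trans (P.sym (VecP.lookup∘tabulate id α)) (P.trans eq (VecP.lookup∘tabulate id β)))

map-identity : ∀ {A : Set} {N} (b : Vec A N) → Vec.map (lookup b) identity ≡ b
map-identity b = P.trans (P.sym (VecP.tabulate-∘ (lookup b) id)) (VecP.tabulate∘lookup b)

∧-true⇒ˡ : ∀ {a b} → (a ∧ b) ≡ true → a ≡ true
∧-true⇒ˡ {true} _ = P.refl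

∧-true⇒ʳ : ∀ a {b} → (a ∧ b) ≡ true → b ≡ true
∧-true⇒ʳ true ab = ab

all-true⇒∈ : ∀ {A : Set} (f : A → Bool) (xs : List A) → allᵇ f xs ≡ true → ∀ {x} → x ∈ xs → f x ≡ true
all-true⇒∈ f (y ∷ xs) all-f (here P.refl) = ∧-true⇒ˡ all-f
all-true⇒∈ f (y ∷ xs) all-f (there x∈xs) = all-true⇒∈ f xs (∧-true⇒ʳ (f y) all-f) x∈xs

Increasing : ∀ {n} → Vec ℕ n → Set
Increasing [] = ⊤
Increasing (x ∷ []) = ⊤
Increasing (x ∷ y ∷ v) = x < y × Increasing (y ∷ v)

strictIncℕ⇒Increasing : ∀ {n} (v : Vec ℕ n) → strictIncℕ v ≡ true → Increasing v
strictIncℕ⇒Increasing [] _ = tt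
strictIncℕ⇒Increasing (x ∷ []) _ = tt
strictIncℕ⇒Increasing (x ∷ y ∷ v) inc =
  ℕP.<ᵇ⇒< x y (Equivalence.from BoolP.T-≡ (∧-true⇒ˡ inc)) , strictIncℕ⇒Increasing (y ∷ v) (∧-true⇒ʳ (x <ᵇ y) inc)

Increasing-tail : ∀ {n} x (v : Vec ℕ n) → Increasing (x ∷ v) → Increasing v
Increasing-tail x [] _ = tt
Increasing-tail x (y ∷ v) (_ , inc) = inc

Increasing-head< : ∀ {n} x (v : Vec ℕ n) → Increasing (x ∷ v) → ∀ α → x < lookup v α
Increasing-head< x (y ∷ v) (x<y , inc) Fin.zero = x<y
Increasing-head< x (y ∷ v) (x<y , inc) (Fin.suc α) = ℕP.<-trans x<y (Increasing-head< y v inc α)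

Increasing-mono : ∀ {n} (v : Vec ℕ n) → Increasing v → ∀ i j → toℕ i ≤ toℕ j → lookup v i ≤ lookup v j
Increasing-mono (x ∷ v) inc Fin.zero Fin.zero _ = ℕP.≤-refl
Increasing-mono (x ∷ v) inc Fin.zero (Fin.suc j) _ = ℕP.<⇒≤ (Increasing-head< x v inc j)
Increasing-mono (x ∷ v) inc (Fin.suc i) (Fin.suc j) (s≤s i≤j) = Increasing-mono v (Increasing-tail x v inc) i j i≤j

Increasing-head+length≤ : ∀ {n} M x (v : Vec ℕ n) → Increasing (x ∷ v) → (∀ α → lookup (x ∷ v) α < M) → suc (n ℕ.+ x) ≤ M
Increasing-head+length≤ M x [] _ bound = bound Fin.zero
Increasing-head+length≤ {suc n} M x (y ∷ v) (x<y , inc) bound =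
  ℕP.≤-trans (s≤s (P.subst (_≤ n ℕ.+ y) (ℕP.+-suc n x) (ℕP.+-monoʳ-≤ n x<y)))
             (Increasing-head+length≤ M y v inc (bound ∘ Fin.suc))

Increasing-interval : ∀ n m (v : Vec ℕ n) → Increasing v → (∀ α → m ≤ lookup v α) → (∀ α → lookup v α < m ℕ.+ n) →
  ∀ α → lookup v α ≡ m ℕ.+ toℕ α
Increasing-interval (suc n) m (x ∷ v) inc lower upper = entry
  where
  x≡m : x ≡ m
  x≡m = ℕP.≤-antisym (ℕP.+-cancelˡ-≤ n x m (ℕP.≤-pred (P.subst (suc (n ℕ.+ x) ≤_)
          (P.trans (ℕP.+-suc m n) (P.cong suc (ℕP.+-comm m n))) (Increasing-head+length≤ (m ℕ.+ suc n) x v inc upper))))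
        (lower Fin.zero)
  entry : ∀ α → lookup (x ∷ v) α ≡ m ℕ.+ toℕ α
  entry Fin.zero = P.trans x≡m (P.sym (ℕP.+-identityʳ m))
  entry (Fin.suc α) = P.trans (Increasing-interval n (suc m) v (Increasing-tail x v inc)
      (λ β → P.subst (λ z → suc z ≤ lookup v β) x≡m (Increasing-head< x v inc β))
      (λ β → P.subst (lookup v β <_) (ℕP.+-suc m n) (upper (Fin.suc β))) α) (P.sym (ℕP.+-suc m (toℕ α)))

Increasing-∘⇒Increasing : ∀ {N n} (b : Vec ℕ N) (ρ : Vec (Fin N) n) →
  Increasing (Vec.map (lookup b) ρ) → Increasing b → Increasing (Vec.map toℕ ρ)
Increasing-∘⇒Increasing b [] _ _ = tt
Increasing-∘⇒Increasing b (x ∷ []) _ _ = tt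
Increasing-∘⇒Increasing b (x ∷ y ∷ ρ) (bx<by , inc) incb = x<y , Increasing-∘⇒Increasing b (y ∷ ρ) inc incb
  where
  x<y : toℕ x < toℕ y
  x<y with toℕ y ℕP.≤? toℕ x
  ... | yes y≤x = ⊥-elim (ℕP.<⇒≱ bx<by (Increasing-mono b incb y x y≤x))
  ... | no y≰x = ℕP.≰⇒> y≰x

Increasing-Fin⇒identity : ∀ {N} (ρ : Vec (Fin N) N) → Increasing (Vec.map toℕ ρ) → ρ ≡ Vec.tabulate id
Increasing-Fin⇒identity {N} ρ inc = P.trans (P.sym (VecP.tabulate∘lookup ρ)) (VecP.tabulate-cong entry)
  where
  entry : ∀ α → lookup ρ α ≡ α
  entry α = FinP.toℕ-injective (P.trans (P.sym (VecP.lookup-map α toℕ ρ))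
    (Increasing-interval N 0 (Vec.map toℕ ρ) inc (λ _ → z≤n)
       (λ β → P.subst (_< N) (P.sym (VecP.lookup-map β toℕ ρ)) (FinP.toℕ<n (lookup ρ β))) α))

eqVec≡eqVecBy : ∀ {n} (u v : Vec ℕ n) → eqVec u v ≡ eqVecBy _≡ᵇ_ u v
eqVec≡eqVecBy [] [] = P.refl
eqVec≡eqVecBy (x ∷ u) (y ∷ v) = P.cong ((x ≡ᵇ y) ∧_) (eqVec≡eqVecBy u v)

eqVec⇒≡ : ∀ {n} (u v : Vec ℕ n) → eqVec u v ≡ true → u ≡ v
eqVec⇒≡ u v eq = eqVecBy⇒≡ ≡ᵇ⇒≡ u v (P.trans (P.sym (eqVec≡eqVecBy u v)) eq)

eqVec-refl : ∀ {n} (u : Vec ℕ n) → eqVec u u ≡ true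
eqVec-refl u = P.trans (eqVec≡eqVecBy u u) (eqVecBy-refl ≡ᵇ-refl u)

module Signs {c ℓ} (R : CommutativeRing c ℓ) where
  open CommutativeRing R
  open ListSums R
  open VecSums R
  open import Relation.Binary.Reasoning.Setoid setoid
  open import Algebra.Properties.CommutativeMonoid.Sum *-commutativeMonoid
    using (sum-permute) renaming (sum to product)

  ∏-allFin≈product : ∀ n (f : Fin n → Carrier) → ∏ (allFin n) f ≈ product f
  ∏-allFin≈product zero f = refl
  ∏-allFin≈product (suc n) f = trans (reflexive (∏-allFin-suc n f)) (*-congˡ (∏-allFin≈product n (f ∘ Fin.suc)))

  ∏-permute : ∀ {N} (σ : Vec (Fin N) N) → noDup σ ≡ true → ∀ (h : Fin N → Carrier) →
    ∏ (allFin N) (h ∘ lookup σ) ≈ ∏ (allFin N) h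
  ∏-permute {N} σ nd h = begin
    ∏ (allFin N) (h ∘ lookup σ) ≈⟨ ∏-allFin≈product N _ ⟩
    product (h ∘ lookup σ)      ≈⟨ sum-permute h (asPermutation σ nd) ⟨
    product h                   ≈⟨ ∏-allFin≈product N h ⟨
    ∏ (allFin N) h              ∎

  sign : ℕ → Carrier
  sign n = if isEven n then 1# else - 1#

  signIf : Bool → Carrier
  signIf b = if b then - 1# else 1#

  sign-suc : ∀ n → sign (suc n) ≈ - sign n
  sign-suc n with isEven n
  ... | true = refl
  ... | false = sym (-‿involutive _)

  sign-+ : ∀ m n → sign (m ℕ.+ n) ≈ sign m * sign n
  sign-+ zero n = sym (*-identityˡ _)
  sign-+ (suc m) n = begin
    sign (suc (m ℕ.+ n))  ≈⟨ sign-suc (m ℕ.+ n) ⟩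
    - sign (m ℕ.+ n)      ≈⟨ -‿cong (sign-+ m n) ⟩
    - (sign m * sign n)   ≈⟨ -‿distribˡ-* _ _ ⟩
    - sign m * sign n     ≈⟨ *-congʳ (sign-suc m) ⟨
    sign (suc m) * sign n ∎

  sign²≈1 : ∀ n → sign n * sign n ≈ 1#
  sign²≈1 n with isEven n
  ... | true = *-identityˡ _
  ... | false = trans (sym (-‿distribˡ-* _ _)) (trans (-‿cong (*-identityˡ _)) (-‿involutive _))

  sign-countGt : ∀ {M n} (x : Fin M) (w : Vec (Fin M) n) →
    sign (countGt x w) ≈ entryProd (λ y → signIf (toℕ y <ᵇ toℕ x)) w
  sign-countGt x [] = refl
  sign-countGt x (y ∷ w) with toℕ y <ᵇ toℕ x
  ... | true = trans (sign-suc (countGt x w)) (trans (sym (-1*x≈-x _)) (*-congˡ (sign-countGt x w)))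
  ... | false = trans (sign-countGt x w) (sym (*-identityˡ _))

  -- The sign of v if v is a permutation and 0 otherwise, so that sums over permutations
  -- can range over all of allVecs (allFin N) N.
  ε : ∀ {M n} → Vec (Fin M) n → Carrier
  ε v = 𝟙 (noDup v) * sign (inversions v)

  ε-noDup : ∀ {M n} (v : Vec (Fin M) n) → noDup v ≡ true → ε v ≈ sign (inversions v)
  ε-noDup v nd rewrite nd = *-identityˡ _

  ε-dup : ∀ {M n} (v : Vec (Fin M) n) → noDup v ≡ false → ε v ≈ 0#
  ε-dup v dup rewrite dup = zeroˡ _

  inversionSign : ∀ {M n} → Vec (Fin M) n → Fin n → Fin n → Carrier
  inversionSign v α β = signIf ((toℕ α <ᵇ toℕ β) ∧ (toℕ (lookup v β) <ᵇ toℕ (lookup v α)))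

  sign-inversions≈∏∏ : ∀ {M n} (v : Vec (Fin M) n) →
    sign (inversions v) ≈ ∏ (allFin n) (λ α → ∏ (allFin n) (inversionSign v α))
  sign-inversions≈∏∏ [] = refl
  sign-inversions≈∏∏ {n = suc n} (x ∷ w) = begin
    sign (countGt x w ℕ.+ inversions w)
      ≈⟨ sign-+ (countGt x w) (inversions w) ⟩
    sign (countGt x w) * sign (inversions w)
      ≈⟨ *-cong (trans (sign-countGt x w) (entryProd≈∏ _ w)) (sign-inversions≈∏∏ w) ⟩
    ∏ (allFin n) (λ β → signIf (toℕ (lookup w β) <ᵇ toℕ x)) * ∏ (allFin n) (λ α → ∏ (allFin n) (inversionSign w α))
      ≈⟨ *-cong (sym (trans (reflexive (∏-allFin-suc n _)) (*-identityˡ _)))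
                (∏-cong (allFin n) (λ α → sym (trans (reflexive (∏-allFin-suc n _)) (*-identityˡ _)))) ⟩
    ∏ (allFin (suc n)) (inversionSign (x ∷ w) Fin.zero) *
    ∏ (allFin n) (λ α → ∏ (allFin (suc n)) (inversionSign (x ∷ w) (Fin.suc α)))
      ≡⟨ ∏-allFin-suc n _ ⟨
    ∏ (allFin (suc n)) (λ α → ∏ (allFin (suc n)) (inversionSign (x ∷ w) α)) ∎

  sign-inverse : ∀ {N} (σ : Vec (Fin N) N) → noDup σ ≡ true → sign (inversions (inverse σ)) ≈ sign (inversions σ)
  sign-inverse {N} σ nd = begin
    sign (inversions (inverse σ))
      ≈⟨ sign-inversions≈∏∏ (inverse σ) ⟩
    ∏ (allFin N) (λ α → ∏ (allFin N) (inversionSign (inverse σ) α))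
      ≈⟨ ∏-permute σ nd _ ⟨
    ∏ (allFin N) (λ α → ∏ (allFin N) (inversionSign (inverse σ) (lookup σ α)))
      ≈⟨ ∏-cong (allFin N) (λ α → sym (∏-permute σ nd _)) ⟩
    ∏ (allFin N) (λ α → ∏ (allFin N) (λ β → inversionSign (inverse σ) (lookup σ α) (lookup σ β)))
      ≈⟨ ∏-cong (allFin N) (λ α → ∏-cong (allFin N) (λ β → reflexive (pairs-swap α β))) ⟩
    ∏ (allFin N) (λ α → ∏ (allFin N) (λ β → inversionSign σ β α))
      ≈⟨ ∏-comm (allFin N) (allFin N) _ ⟩
    ∏ (allFin N) (λ β → ∏ (allFin N) (inversionSign σ β))
      ≈⟨ sign-inversions≈∏∏ σ ⟨
    sign (inversions σ) ∎
    where
    pairs-swap : ∀ α β → inversionSign (inverse σ) (lookup σ α) (lookup σ β) ≡ inversionSign σ β α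
    pairs-swap α β rewrite inverseˡ σ nd α | inverseˡ σ nd β =
      P.cong signIf (BoolP.∧-comm (toℕ (lookup σ α) <ᵇ toℕ (lookup σ β)) (toℕ β <ᵇ toℕ α))

  ε-inverse : ∀ {N} (σ : Vec (Fin N) N) → noDup σ ≡ true → ε (inverse σ) ≈ ε σ
  ε-inverse σ nd = trans (ε-noDup (inverse σ) (inverse-noDup σ nd)) (trans (sign-inverse σ nd) (sym (ε-noDup σ nd)))

  ε-∏-permute : ∀ {N} (σ : Vec (Fin N) N) (h : Fin N → Carrier) →
    ε σ * ∏ (allFin N) (h ∘ lookup σ) ≈ ε σ * ∏ (allFin N) h
  ε-∏-permute σ h with true-or-false (noDup σ)
  ... | inj₁ nd = *-congˡ (∏-permute σ nd h)
  ... | inj₂ dup = both-zero (*-≈0ˡ _ (ε-dup σ dup)) (*-≈0ˡ _ (ε-dup σ dup))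

  signIf-anti : ∀ m n → m ≢ n → signIf (m <ᵇ n) ≈ - signIf (n <ᵇ m)
  signIf-anti zero zero m≢n = ⊥-elim (m≢n P.refl)
  signIf-anti zero (suc n) _ = refl
  signIf-anti (suc m) zero _ = sym (-‿involutive _)
  signIf-anti (suc m) (suc n) m≢n = signIf-anti m n (m≢n ∘ P.cong suc)

  sign-swapAt : ∀ {M n} (a : Fin n) (v : Vec (Fin M) (suc n)) → noDup v ≡ true →
    sign (inversions (swapAt a v)) ≈ - sign (inversions v)
  sign-swapAt Fin.zero (x ∷ y ∷ w) nd = begin
    sign (inversions (y ∷ x ∷ w))                                  ≈⟨ expand y x ⟩
    (signIf (toℕ x <ᵇ toℕ y) * B) * (A * C)                        ≈⟨ *-congʳ (*-congʳ (signIf-anti _ _ x≢y)) ⟩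
    (- signIf (toℕ y <ᵇ toℕ x) * B) * (A * C)                      ≈⟨ *-congʳ (-‿distribˡ-* _ _) ⟨
    - (signIf (toℕ y <ᵇ toℕ x) * B) * (A * C)                      ≈⟨ -‿distribˡ-* _ _ ⟨
    - ((signIf (toℕ y <ᵇ toℕ x) * B) * (A * C))                    ≈⟨ -‿cong (*-interchange _ _ _ _) ⟩
    - ((signIf (toℕ y <ᵇ toℕ x) * A) * (B * C))                    ≈⟨ -‿cong (expand x y) ⟨
    - sign (inversions (x ∷ y ∷ w))                                ∎
    where
    A = sign (countGt x w)
    B = sign (countGt y w)
    C = sign (inversions w)
    x≢y : toℕ x ≢ toℕ y
    x≢y eq with noDup⇒injective (x ∷ y ∷ w) nd Fin.zero (Fin.suc Fin.zero) (FinP.toℕ-injective eq)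
    ... | ()
    expand : ∀ u z → sign (inversions (u ∷ z ∷ w)) ≈
      (signIf (toℕ z <ᵇ toℕ u) * sign (countGt u w)) * (sign (countGt z w) * sign (inversions w))
    expand u z = trans (sign-+ (countGt u (z ∷ w)) _)
      (*-cong (trans (sign-countGt u (z ∷ w)) (*-congˡ (sym (sign-countGt u w)))) (sign-+ (countGt z w) _))
  sign-swapAt (Fin.suc a) (x ∷ w) nd = begin
    sign (countGt x (swapAt a w) ℕ.+ inversions (swapAt a w))
      ≈⟨ sign-+ (countGt x (swapAt a w)) _ ⟩
    sign (countGt x (swapAt a w)) * sign (inversions (swapAt a w))
      ≈⟨ *-cong (reflexive (P.cong sign (countGt-swapAt x a w))) (sign-swapAt a w (noDup-tail x w nd)) ⟩
    sign (countGt x w) * - sign (inversions w)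
      ≈⟨ -‿distribʳ-* _ _ ⟨
    - (sign (countGt x w) * sign (inversions w))
      ≈⟨ -‿cong (sign-+ (countGt x w) _) ⟨
    - sign (countGt x w ℕ.+ inversions w) ∎

  ε-swapAt : ∀ {M n} (a : Fin n) (v : Vec (Fin M) (suc n)) → ε (swapAt a v) ≈ - ε v
  ε-swapAt a v with true-or-false (noDup v)
  ... | inj₂ dup = both-zero (ε-dup (swapAt a v) (P.trans (noDup-swapAt a v) dup)) (trans (-‿cong (ε-dup v dup)) -0#≈0#)
  ... | inj₁ nd = trans (ε-noDup (swapAt a v) (P.trans (noDup-swapAt a v) nd))
                        (trans (sign-swapAt a v nd) (-‿cong (sym (ε-noDup v nd))))

  ε-repeats : ∀ {M n} (a : Fin n) (v : Vec (Fin M) (suc n)) → RepeatsAt a v → ε v ≈ 0#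
  ε-repeats a v r = ε-dup v (repeats⇒dup a v r)

  ε-identity : ∀ {N} → ε (identity {N}) ≈ 1#
  ε-identity {N} = trans (ε-noDup (identity {N}) (noDup-identity {N}))
    (trans (sign-inversions≈∏∏ (identity {N})) (∏-one (allFin N) (λ α → ∏-one (allFin N) (λ β → reflexive (no-inversion α β)))))
    where
    no-inversion : ∀ α β → inversionSign (identity {N}) α β ≡ 1#
    no-inversion α β rewrite VecP.lookup∘tabulate id α | VecP.lookup∘tabulate id β | <ᵇ-asym (toℕ α) (toℕ β) = P.refl

  ε-𝟙-eqVec-permuted : ∀ {N} (c b : Vec ℕ N) → Increasing c → Increasing b → ∀ (ρ : Vec (Fin N) N) →
    ε ρ * 𝟙 (eqVec c (Vec.map (lookup b) ρ)) ≈ 𝟙 (eqFinVec ρ identity) * 𝟙 (eqVec c b)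
  ε-𝟙-eqVec-permuted {N} c b incc incb ρ with true-or-false (eqVec c (Vec.map (lookup b) ρ))
  ... | inj₁ c≡bρ = begin
    ε ρ * 𝟙 (eqVec c (Vec.map (lookup b) ρ))
      ≈⟨ trans (*-congˡ (𝟙-true c≡bρ)) (*-identityʳ _) ⟩
    ε ρ
      ≡⟨ P.cong ε ρ≡id ⟩
    ε (identity {N})
      ≈⟨ ε-identity {N} ⟩
    1#
      ≈⟨ *-identityˡ 1# ⟨
    1# * 1#
      ≈⟨ *-cong (𝟙-true (P.subst (λ z → eqFinVec z identity ≡ true) (P.sym ρ≡id) (eqFinVec-refl (identity {N}))))
                (𝟙-true (P.subst (λ z → eqVec z b ≡ true) (P.sym c≡b) (eqVec-refl b))) ⟨
    𝟙 (eqFinVec ρ identity) * 𝟙 (eqVec c b) ∎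
    where
    c≡ : c ≡ Vec.map (lookup b) ρ
    c≡ = eqVec⇒≡ c _ c≡bρ
    ρ≡id : ρ ≡ identity
    ρ≡id = Increasing-Fin⇒identity ρ (Increasing-∘⇒Increasing b ρ (P.subst Increasing c≡ incc) incb)
    c≡b : c ≡ b
    c≡b = P.trans c≡ (P.trans (P.cong (Vec.map (lookup b)) ρ≡id) (map-identity b))
  ... | inj₂ c≢bρ with true-or-false (eqFinVec ρ identity)
  ...   | inj₂ ρ≢id = both-zero (*-≈0ʳ _ (𝟙-false c≢bρ)) (*-≈0ˡ _ (𝟙-false ρ≢id))
  ...   | inj₁ ρ≡id = both-zero (*-≈0ʳ _ (𝟙-false c≢bρ)) (*-≈0ʳ _ (𝟙-false c≢b))
    where
    c≢b : eqVec c b ≡ false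
    c≢b = P.trans (P.cong (eqVec c) (P.sym (P.trans (P.cong (Vec.map (lookup b)) (eqFinVec⇒≡ ρ identity ρ≡id))
                                                     (map-identity b)))) c≢bρ

module Determinants {c ℓ} (R : CommutativeRing c ℓ) where
  open CommutativeRing R
  open ListSums R
  open VecSums R
  open Signs R
  open import Relation.Binary.Reasoning.Setoid setoid

  -- The determinant of the matrix whose entry in row γ and column β is H γ (lookup u β).
  det : ∀ {B : Set} {N} → (Fin N → B → Carrier) → Vec B N → Carrier
  det {N = N} H u = ∑ (allVecs (allFin N) N) (λ ρ → ε ρ * zipProd H ρ u)

  det-swapAt : ∀ {B : Set} {n} (H : Fin (suc n) → B → Carrier) (a : Fin n) (u : Vec B (suc n)) →
    det H (swapAt a u) ≈ - det H u
  det-swapAt {n = n} H a u = begin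
    ∑ maps (λ ρ → ε ρ * zipProd H ρ (swapAt a u))
      ≈⟨ ∑-allVecs-swapAt (allFin (suc n)) a _ ⟨
    ∑ maps (λ ρ → ε (swapAt a ρ) * zipProd H (swapAt a ρ) (swapAt a u))
      ≈⟨ ∑-cong maps (λ ρ → *-cong (ε-swapAt a ρ) (zipProd-swapAt H a ρ u)) ⟩
    ∑ maps (λ ρ → - ε ρ * zipProd H ρ u)
      ≈⟨ ∑-cong maps (λ ρ → -‿distribˡ-* _ _) ⟨
    ∑ maps (λ ρ → - (ε ρ * zipProd H ρ u))
      ≈⟨ -‿∑ maps _ ⟨
    - det H u ∎
    where maps = allVecs (allFin (suc n)) (suc n)

  det-repeats : ∀ {B : Set} {n} (H : Fin (suc n) → B → Carrier) (a : Fin n) (u : Vec B (suc n)) →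
    RepeatsAt a u → det H u ≈ 0#
  det-repeats {n = n} H a u r = ∑-allVecs-antisymmetric (allFin (suc n)) a _ anti vanish
    where
    anti : ∀ ρ → ε (swapAt a ρ) * zipProd H (swapAt a ρ) u ≈ - (ε ρ * zipProd H ρ u)
    anti ρ = begin
      ε (swapAt a ρ) * zipProd H (swapAt a ρ) u
        ≡⟨ P.cong (λ z → ε (swapAt a ρ) * zipProd H (swapAt a ρ) z) (swapAt-repeats a u r) ⟨
      ε (swapAt a ρ) * zipProd H (swapAt a ρ) (swapAt a u)
        ≈⟨ *-cong (ε-swapAt a ρ) (zipProd-swapAt H a ρ u) ⟩
      - ε ρ * zipProd H ρ u
        ≈⟨ -‿distribˡ-* _ _ ⟨
      - (ε ρ * zipProd H ρ u) ∎
    vanish : ∀ ρ → RepeatsAt a ρ → ε ρ * zipProd H ρ u ≈ 0#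
    vanish ρ rρ = *-≈0ˡ _ (ε-repeats a ρ rρ)

  Edet≈det : ∀ {K N} (C : Fin K → ℕ → Carrier) (k : Vec (Fin K) N) (y : Vec ℕ N) →
    Edet R C k y ≈ det (C ∘ lookup k) y
  Edet≈det {K} {N} C k y = trans (∑-filterᵇ noDup (allVecs (allFin N) N) _)
    (∑-cong (allVecs (allFin N) N) (λ σ → trans (sym (*-assoc _ _ _)) (*-congˡ (zipProd≈∏ (C ∘ lookup k) σ y))))

  ∑-𝟙-eqFinVec : ∀ {N} n (u : Vec (Fin N) n) (F : Vec (Fin N) n → Carrier) →
    ∑ (allVecs (allFin N) n) (λ v → 𝟙 (eqFinVec v u) * F v) ≈ F u
  ∑-𝟙-eqFinVec {N} n u = ∑-allVecs-𝟙-eq (allFin N) _ n u (λ α → ∑-𝟙-allFin N (lookup u α))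

  module _ {N} (σ ρ : Vec (Fin N) N) where

    ε-mutual-inverses : ρ ≡ inverse σ → σ ≡ inverse ρ → ε σ ≈ ε ρ
    ε-mutual-inverses ρ≡σ⁻¹ σ≡ρ⁻¹ with true-or-false (noDup σ) | true-or-false (noDup ρ)
    ... | inj₁ nσ | _ = sym (trans (reflexive (P.cong ε ρ≡σ⁻¹)) (ε-inverse σ nσ))
    ... | inj₂ _ | inj₁ nρ = trans (reflexive (P.cong ε σ≡ρ⁻¹)) (ε-inverse ρ nρ)
    ... | inj₂ dσ | inj₂ dρ = trans (ε-dup σ dσ) (sym (ε-dup ρ dρ))

    ε-one-sided-inverse : ρ ≡ inverse σ → eqFinVec σ (inverse ρ) ≡ false → ε σ ≈ 0#
    ε-one-sided-inverse P.refl σ≢ρ⁻¹ with true-or-false (noDup σ)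
    ... | inj₂ dσ = ε-dup σ dσ
    ... | inj₁ nσ with P.trans (P.sym σ≢ρ⁻¹) (P.subst (λ z → eqFinVec σ z ≡ true)
                                                    (P.sym (inverse-involutive σ nσ)) (eqFinVec-refl σ))
    ...   | ()

  ε-𝟙-inverse : ∀ {N} (σ ρ : Vec (Fin N) N) →
    ε σ * 𝟙 (eqFinVec ρ (inverse σ)) ≈ 𝟙 (eqFinVec σ (inverse ρ)) * ε ρ
  ε-𝟙-inverse σ ρ with eqFinVec ρ (inverse σ) in e₁ | eqFinVec σ (inverse ρ) in e₂
  ... | false | false = both-zero (zeroʳ _) (zeroˡ _)
  ... | true | true = trans (*-identityʳ _) (trans (ε-mutual-inverses σ ρ (eqFinVec⇒≡ _ _ e₁) (eqFinVec⇒≡ _ _ e₂))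
                                                  (sym (*-identityˡ _)))
  ... | true | false = both-zero (trans (*-identityʳ _) (ε-one-sided-inverse σ ρ (eqFinVec⇒≡ _ _ e₁) e₂)) (zeroˡ _)
  ... | false | true = both-zero (zeroʳ _) (trans (*-identityˡ _) (ε-one-sided-inverse ρ σ (eqFinVec⇒≡ _ _ e₂) e₁))

  -- The reindexing σ ↦ σ⁻¹ goes through the indicator of ρ = σ⁻¹, which ε-𝟙-inverse
  -- makes symmetric in σ and ρ.
  det-transpose : ∀ {N} (M : Fin N → Fin N → Carrier) →
    ∑ (allVecs (allFin N) N) (λ σ → ε σ * ∏ (allFin N) (λ α → M (lookup σ α) α)) ≈
    ∑ (allVecs (allFin N) N) (λ ρ → ε ρ * ∏ (allFin N) (λ β → M β (lookup ρ β)))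
  det-transpose {N} M = begin
    ∑ maps (λ σ → ε σ * ∏ (allFin N) (λ α → M (lookup σ α) α))
      ≈⟨ ∑-cong maps reindex ⟩
    ∑ maps (λ σ → ε σ * X (inverse σ))
      ≈⟨ ∑-cong maps (λ σ → *-congˡ (∑-𝟙-eqFinVec N (inverse σ) X)) ⟨
    ∑ maps (λ σ → ε σ * ∑ maps (λ ρ → 𝟙 (eqFinVec ρ (inverse σ)) * X ρ))
      ≈⟨ ∑-cong maps (λ σ → *-distribˡ-∑ maps _ _) ⟩
    ∑ maps (λ σ → ∑ maps (λ ρ → ε σ * (𝟙 (eqFinVec ρ (inverse σ)) * X ρ)))
      ≈⟨ ∑-comm maps maps _ ⟩
    ∑ maps (λ ρ → ∑ maps (λ σ → ε σ * (𝟙 (eqFinVec ρ (inverse σ)) * X ρ)))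
      ≈⟨ ∑-cong maps (λ ρ → ∑-cong maps (λ σ → swap-ε σ ρ)) ⟩
    ∑ maps (λ ρ → ∑ maps (λ σ → 𝟙 (eqFinVec σ (inverse ρ)) * (ε ρ * X ρ)))
      ≈⟨ ∑-cong maps (λ ρ → ∑-𝟙-eqFinVec N (inverse ρ) _) ⟩
    ∑ maps (λ ρ → ε ρ * X ρ) ∎
    where
    maps = allVecs (allFin N) N
    X : Vec (Fin N) N → Carrier
    X ρ = ∏ (allFin N) (λ β → M β (lookup ρ β))
    reindex : ∀ σ → ε σ * ∏ (allFin N) (λ α → M (lookup σ α) α) ≈ ε σ * X (inverse σ)
    reindex σ with true-or-false (noDup σ)
    ... | inj₂ dσ = both-zero (*-≈0ˡ _ (ε-dup σ dσ)) (*-≈0ˡ _ (ε-dup σ dσ))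
    ... | inj₁ nd = *-congˡ (begin
      ∏ (allFin N) (λ α → M (lookup σ α) α)
        ≈⟨ ∏-cong (allFin N) (λ α → reflexive (P.cong (M (lookup σ α)) (P.sym (inverseˡ σ nd α)))) ⟩
      ∏ (allFin N) (λ α → M (lookup σ α) (lookup (inverse σ) (lookup σ α)))
        ≈⟨ ∏-permute σ nd (λ β → M β (lookup (inverse σ) β)) ⟩
      X (inverse σ) ∎)
    swap-ε : ∀ σ ρ → ε σ * (𝟙 (eqFinVec ρ (inverse σ)) * X ρ) ≈ 𝟙 (eqFinVec σ (inverse ρ)) * (ε ρ * X ρ)
    swap-ε σ ρ = trans (sym (*-assoc _ _ _)) (trans (*-congʳ (ε-𝟙-inverse σ ρ)) (*-assoc _ _ _))

  Edet≈det-transposed : ∀ {K N} (C : Fin K → ℕ → Carrier) (k : Vec (Fin K) N) (y : Vec ℕ N) →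
    Edet R C k y ≈ det (λ γ j → C j (lookup y γ)) k
  Edet≈det-transposed {N = N} C k y = begin
    Edet R C k y
      ≈⟨ Edet≈det C k y ⟩
    det (C ∘ lookup k) y
      ≈⟨ ∑-cong (allVecs (allFin N) N) (λ σ → *-congˡ (sym (zipProd≈∏ (C ∘ lookup k) σ y))) ⟩
    ∑ (allVecs (allFin N) N) (λ σ → ε σ * ∏ (allFin N) (λ α → C (lookup k (lookup σ α)) (lookup y α)))
      ≈⟨ det-transpose (λ γ α → C (lookup k γ) (lookup y α)) ⟩
    ∑ (allVecs (allFin N) N) (λ ρ → ε ρ * ∏ (allFin N) (λ β → C (lookup k β) (lookup y (lookup ρ β))))
      ≈⟨ ∑-cong (allVecs (allFin N) N) (λ ρ → *-congˡ (zipProd≈∏ (λ γ j → C j (lookup y γ)) ρ k)) ⟩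
    det (λ γ j → C j (lookup y γ)) k ∎

  alt : ∀ {K N} → (Vec (Fin K) N → Carrier) → Vec (Fin K) N → Carrier
  alt {N = N} Q k = ∑ (allVecs (allFin N) N) (λ σ → ε σ * Q (Vec.map (lookup k) σ))

  Edet≈alt : ∀ {K N} (C : Fin K → ℕ → Carrier) (k : Vec (Fin K) N) (y : Vec ℕ N) →
    Edet R C k y ≈ alt (λ f → zipProd C f y) k
  Edet≈alt {N = N} C k y = trans (Edet≈det C k y)
    (∑-cong (allVecs (allFin N) N) (λ σ → *-congˡ (reflexive (zipProd-mapˡ (lookup k) C σ y))))

  avoids : ∀ {M} → Fin M → Fin M → Carrier
  avoids i x = 𝟙 (not (toℕ i ≡ᵇ toℕ x))

  below : ∀ {M} → Fin M → Fin M → Carrier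
  below i x = signIf (toℕ x <ᵇ toℕ i)

  𝟙-not-memFin : ∀ {M n} (i : Fin M) (v : Vec (Fin M) n) → 𝟙 (not (memFin i v)) ≈ entryProd (avoids i) v
  𝟙-not-memFin i [] = refl
  𝟙-not-memFin i (j ∷ v) with toℕ i ≡ᵇ toℕ j
  ... | true = sym (zeroˡ _)
  ... | false = trans (𝟙-not-memFin i v) (sym (*-identityˡ _))

  ε-∷ : ∀ {M n} (i : Fin M) (v : Vec (Fin M) n) → ε (i ∷ v) ≈ entryProd (avoids i) v * (entryProd (below i) v * ε v)
  ε-∷ i v = begin
    𝟙 (not (memFin i v) ∧ noDup v) * sign (countGt i v ℕ.+ inversions v)
      ≈⟨ *-cong (𝟙-∧ _ _) (sign-+ (countGt i v) _) ⟩
    (𝟙 (not (memFin i v)) * 𝟙 (noDup v)) * (sign (countGt i v) * sign (inversions v))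
      ≈⟨ *-interchange _ _ _ _ ⟩
    (𝟙 (not (memFin i v)) * sign (countGt i v)) * ε v
      ≈⟨ *-assoc _ _ _ ⟩
    𝟙 (not (memFin i v)) * (sign (countGt i v) * ε v)
      ≈⟨ *-cong (𝟙-not-memFin i v) (*-congʳ (sign-countGt i v)) ⟩
    entryProd (avoids i) v * (entryProd (below i) v * ε v) ∎

  ∑-avoiding : ∀ {n} (i : Fin (suc n)) (f : Fin (suc n) → Carrier) →
    ∑ (allFin (suc n)) (λ x → avoids i x * f x) ≈ ∑ (allFin n) (f ∘ punchIn i)
  ∑-avoiding {n} Fin.zero f = begin
    ∑ (allFin (suc n)) (λ x → avoids Fin.zero x * f x)            ≡⟨ ∑-allFin-suc n _ ⟩
    0# * f Fin.zero + ∑ (allFin n) (λ x → 1# * f (Fin.suc x))  ≈⟨ +-cong (zeroˡ _) (∑-cong (allFin n) (λ x → *-identityˡ _)) ⟩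
    0# + ∑ (allFin n) (f ∘ Fin.suc)                              ≈⟨ +-identityˡ _ ⟩
    ∑ (allFin n) (f ∘ punchIn Fin.zero)                          ∎
  ∑-avoiding {suc n} (Fin.suc i) f = begin
    ∑ (allFin (suc (suc n))) (λ x → avoids (Fin.suc i) x * f x)
      ≡⟨ ∑-allFin-suc (suc n) _ ⟩
    1# * f Fin.zero + ∑ (allFin (suc n)) (λ x → avoids i x * f (Fin.suc x))
      ≈⟨ +-cong (*-identityˡ _) (∑-avoiding i (f ∘ Fin.suc)) ⟩
    f Fin.zero + ∑ (allFin n) (f ∘ Fin.suc ∘ punchIn i)
      ≡⟨ ∑-allFin-suc n _ ⟨
    ∑ (allFin (suc n)) (f ∘ punchIn (Fin.suc i)) ∎

  ∏-below : ∀ {n} (i : Fin (suc n)) → ∏ (allFin n) (below i ∘ punchIn i) ≈ sign (toℕ i)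
  ∏-below {n} Fin.zero = ∏-one (allFin n) (λ _ → refl)
  ∏-below {suc n} (Fin.suc i) = begin
    ∏ (allFin (suc n)) (below (Fin.suc i) ∘ punchIn (Fin.suc i)) ≡⟨ ∏-allFin-suc n _ ⟩
    - 1# * ∏ (allFin n) (below i ∘ punchIn i)                     ≈⟨ *-congˡ (∏-below i) ⟩
    - 1# * sign (toℕ i)                                           ≈⟨ -1*x≈-x _ ⟩
    - sign (toℕ i)                                                ≈⟨ sign-suc (toℕ i) ⟨
    sign (suc (toℕ i))                                            ∎

  entryProd-below-ε : ∀ {n} (i : Fin (suc n)) (τ : Vec (Fin n) n) →
    entryProd (below i ∘ punchIn i) τ * ε τ ≈ sign (toℕ i) * ε τ
  entryProd-below-ε {n} i τ = begin
    entryProd (below i ∘ punchIn i) τ * ε τ          ≈⟨ trans (*-comm _ _) (*-congˡ (entryProd≈∏ _ τ)) ⟩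
    ε τ * ∏ (allFin n) (below i ∘ punchIn i ∘ lookup τ) ≈⟨ ε-∏-permute τ (below i ∘ punchIn i) ⟩
    ε τ * ∏ (allFin n) (below i ∘ punchIn i)          ≈⟨ trans (*-congˡ (∏-below i)) (*-comm _ _) ⟩
    sign (toℕ i) * ε τ                                ∎

  ε-punchIn : ∀ {n m} (i : Fin (suc n)) (τ : Vec (Fin n) m) → ε (Vec.map (punchIn i) τ) ≡ ε τ
  ε-punchIn i τ = P.cong₂ (λ b k → 𝟙 b * sign k) (noDup-map τ) (inversions-map τ)
    where open OrderEmbedding (punchIn i) (punchIn-<ᵇ i) (punchIn-≡ᵇ i)

  alt-laplace : ∀ {K n} (Q : Vec (Fin K) (suc n) → Carrier) (k : Vec (Fin K) (suc n)) →
    alt Q k ≈ ∑ (allFin (suc n)) (λ i → sign (toℕ i) * alt (λ h → Q (lookup k i ∷ h)) (removeAt k i))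
  alt-laplace {K} {n} Q k = begin
    alt Q k
      ≈⟨ ∑-allVecs-suc (allFin (suc n)) n _ ⟩
    ∑ positions (λ i → ∑ (allVecs positions n) (λ σ → ε (i ∷ σ) * Q (lookup k i ∷ Vec.map (lookup k) σ)))
      ≈⟨ ∑-cong positions (λ i → ∑-cong (allVecs positions n) (λ σ → trans (*-congʳ (ε-∷ i σ)) (*-assoc _ _ _))) ⟩
    ∑ positions (λ i → ∑ (allVecs positions n) (λ σ → entryProd (avoids i) σ *
      (entryProd (below i) σ * ε σ * Q (lookup k i ∷ Vec.map (lookup k) σ))))
      ≈⟨ ∑-cong positions (λ i → ∑-allVecs-weighted-map positions (allFin n) (punchIn i) (avoids i) (∑-avoiding i) n _) ⟩
    ∑ positions (λ i → ∑ (allVecs (allFin n) n) (λ τ → entryProd (below i) (Vec.map (punchIn i) τ) *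
      ε (Vec.map (punchIn i) τ) * Q (lookup k i ∷ Vec.map (lookup k) (Vec.map (punchIn i) τ))))
      ≈⟨ ∑-cong positions (λ i → ∑-cong (allVecs (allFin n) n) (λ τ → reflexive (P.cong₂ _*_
           (P.cong₂ _*_ (entryProd-map (below i) (punchIn i) τ) (ε-punchIn i τ))
           (P.cong (λ z → Q (lookup k i ∷ z)) (map-lookup-punchIn k i τ))))) ⟩
    ∑ positions (λ i → ∑ (allVecs (allFin n) n) (λ τ → entryProd (below i ∘ punchIn i) τ * ε τ *
      Q (lookup k i ∷ Vec.map (lookup (removeAt k i)) τ)))
      ≈⟨ ∑-cong positions (λ i → ∑-cong (allVecs (allFin n) n) (λ τ → trans (*-congʳ (entryProd-below-ε i τ)) (*-assoc _ _ _))) ⟩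
    ∑ positions (λ i → ∑ (allVecs (allFin n) n) (λ τ → sign (toℕ i) * (ε τ * Q (lookup k i ∷ Vec.map (lookup (removeAt k i)) τ))))
      ≈⟨ ∑-cong positions (λ i → *-distribˡ-∑ (allVecs (allFin n) n) _ _) ⟨
    ∑ positions (λ i → sign (toℕ i) * alt (λ h → Q (lookup k i ∷ h)) (removeAt k i)) ∎
    where positions = allFin (suc n)

increasingFrom : ∀ {K n} → ℕ → Vec (Fin K) n → Bool
increasingFrom b [] = true
increasingFrom b (x ∷ h) = (b ≤ᵇ toℕ x) ∧ increasingFrom (suc (toℕ x)) h

strictIncFin-∷ : ∀ {K n} (x : Fin K) (h : Vec (Fin K) n) → strictIncFin (x ∷ h) ≡ increasingFrom (suc (toℕ x)) h
strictIncFin-∷ x [] = P.refl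
strictIncFin-∷ x (y ∷ h) = P.cong ((toℕ x <ᵇ toℕ y) ∧_) (strictIncFin-∷ y h)

strictIncFin≡increasingFrom0 : ∀ {K n} (h : Vec (Fin K) n) → strictIncFin h ≡ increasingFrom 0 h
strictIncFin≡increasingFrom0 [] = P.refl
strictIncFin≡increasingFrom0 (x ∷ h) = strictIncFin-∷ x h

suc-≤ᵇ-suc : ∀ b x → (suc b ≤ᵇ suc x) ≡ (b ≤ᵇ x)
suc-≤ᵇ-suc zero x = P.refl
suc-≤ᵇ-suc (suc b) x = P.refl

memFin-suc : ∀ {K n} (x : Fin K) (h : Vec (Fin K) n) → memFin (Fin.suc x) (Vec.map Fin.suc h) ≡ memFin x h
memFin-suc x [] = P.refl
memFin-suc x (y ∷ h) rewrite memFin-suc x h = P.refl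

removeAt-map : ∀ {A B : Set} {n} (g : A → B) (k : Vec A (suc n)) i → removeAt (Vec.map g k) i ≡ Vec.map g (removeAt k i)
removeAt-map g (x ∷ k) Fin.zero = P.refl
removeAt-map g (x ∷ y ∷ k) (Fin.suc i) = P.cong (g x ∷_) (removeAt-map g (y ∷ k) i)

module CauchyBinet {c ℓ} (R : CommutativeRing c ℓ) where
  open CommutativeRing R
  open ListSums R
  open VecSums R
  open Signs R
  open Determinants R
  open import Relation.Binary.Reasoning.Setoid setoid

  ∑-increasingFrom-suc : ∀ {K} n b (G : Vec (Fin (suc K)) n → Carrier) →
    ∑ (allVecs (allFin (suc K)) n) (λ h → 𝟙 (increasingFrom (suc b) h) * G h) ≈
    ∑ (allVecs (allFin K) n) (λ h → 𝟙 (increasingFrom b h) * G (Vec.map Fin.suc h))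
  ∑-increasingFrom-suc zero b G = refl
  ∑-increasingFrom-suc {K} (suc n) b G = begin
    ∑ (allVecs (allFin (suc K)) (suc n)) (λ h → 𝟙 (increasingFrom (suc b) h) * G h)
      ≈⟨ ∑-allVecs-suc (allFin (suc K)) n _ ⟩
    ∑ (allFin (suc K)) (λ x → ∑ tails (λ h → 𝟙 ((suc b ≤ᵇ toℕ x) ∧ increasingFrom (suc (toℕ x)) h) * G (x ∷ h)))
      ≡⟨ ∑-allFin-suc K _ ⟩
    ∑ tails (λ h → 0# * G (Fin.zero ∷ h)) +
    ∑ (allFin K) (λ x → ∑ tails (λ h → 𝟙 ((suc b ≤ᵇ suc (toℕ x)) ∧ increasingFrom (suc (suc (toℕ x))) h) * G (Fin.suc x ∷ h)))
      ≈⟨ +-cong (∑-zero tails (λ _ → zeroˡ _)) (∑-cong (allFin K) (λ x → ∑-cong tails (λ h →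
           trans (*-congʳ (trans (reflexive (P.cong (λ z → 𝟙 (z ∧ _)) (suc-≤ᵇ-suc b (toℕ x)))) (𝟙-∧ _ _))) (*-assoc _ _ _)))) ⟩
    0# + ∑ (allFin K) (λ x → ∑ tails (λ h → 𝟙 (b ≤ᵇ toℕ x) * (𝟙 (increasingFrom (suc (suc (toℕ x))) h) * G (Fin.suc x ∷ h))))
      ≈⟨ +-identityˡ _ ⟩
    ∑ (allFin K) (λ x → ∑ tails (λ h → 𝟙 (b ≤ᵇ toℕ x) * (𝟙 (increasingFrom (suc (suc (toℕ x))) h) * G (Fin.suc x ∷ h))))
      ≈⟨ ∑-cong (allFin K) (λ x → trans (sym (*-distribˡ-∑ tails _ _))
                                        (*-congˡ (∑-increasingFrom-suc n (suc (toℕ x)) (G ∘ (Fin.suc x ∷_))))) ⟩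
    ∑ (allFin K) (λ x → 𝟙 (b ≤ᵇ toℕ x) * ∑ tails′ (λ h → 𝟙 (increasingFrom (suc (toℕ x)) h) * G (Fin.suc x ∷ Vec.map Fin.suc h)))
      ≈⟨ ∑-cong (allFin K) (λ x → trans (*-distribˡ-∑ tails′ _ _)
           (∑-cong tails′ (λ h → trans (sym (*-assoc _ _ _)) (*-congʳ (sym (𝟙-∧ _ _)))))) ⟩
    ∑ (allFin K) (λ x → ∑ tails′ (λ h → 𝟙 (increasingFrom b (x ∷ h)) * G (Vec.map Fin.suc (x ∷ h))))
      ≈⟨ ∑-allVecs-suc (allFin K) n _ ⟨
    ∑ (allVecs (allFin K) (suc n)) (λ h → 𝟙 (increasingFrom b h) * G (Vec.map Fin.suc h)) ∎
    where
    tails = allVecs (allFin (suc K)) n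
    tails′ = allVecs (allFin K) n

  ∑-Kset≈∑-increasingFrom : ∀ {K n} (F : Vec (Fin K) n → Carrier) →
    ∑ (Kset K n) F ≈ ∑ (allVecs (allFin K) n) (λ h → 𝟙 (increasingFrom 0 h) * F h)
  ∑-Kset≈∑-increasingFrom {K} {n} F = trans (∑-filterᵇ strictIncFin (allVecs (allFin K) n) F)
    (∑-cong (allVecs (allFin K) n) (λ h → reflexive (P.cong (λ z → 𝟙 z * F h) (strictIncFin≡increasingFrom0 h))))

  ∑-Kset-split : ∀ {K n} (F : Vec (Fin (suc K)) (suc n) → Carrier) →
    ∑ (Kset (suc K) (suc n)) F ≈
    ∑ (Kset K n) (λ h → F (Fin.zero ∷ Vec.map Fin.suc h)) + ∑ (Kset K (suc n)) (F ∘ Vec.map Fin.suc)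
  ∑-Kset-split {K} {n} F = begin
    ∑ (Kset (suc K) (suc n)) F
      ≈⟨ ∑-filterᵇ strictIncFin (allVecs (allFin (suc K)) (suc n)) F ⟩
    ∑ (allVecs (allFin (suc K)) (suc n)) (λ k → 𝟙 (strictIncFin k) * F k)
      ≈⟨ ∑-allVecs-suc (allFin (suc K)) n _ ⟩
    ∑ (allFin (suc K)) (λ x → ∑ (allVecs (allFin (suc K)) n) (λ h → 𝟙 (strictIncFin (x ∷ h)) * F (x ∷ h)))
      ≈⟨ ∑-cong (allFin (suc K)) (λ x → ∑-cong (allVecs (allFin (suc K)) n) (λ h →
           reflexive (P.cong (λ z → 𝟙 z * F (x ∷ h)) (strictIncFin-∷ x h)))) ⟩
    ∑ (allFin (suc K)) (λ x → ∑ (allVecs (allFin (suc K)) n) (λ h → 𝟙 (increasingFrom (suc (toℕ x)) h) * F (x ∷ h)))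
      ≡⟨ ∑-allFin-suc K _ ⟩
    ∑ (allVecs (allFin (suc K)) n) (λ h → 𝟙 (increasingFrom 1 h) * F (Fin.zero ∷ h)) +
    ∑ (allFin K) (λ x → ∑ (allVecs (allFin (suc K)) n) (λ h → 𝟙 (increasingFrom (suc (suc (toℕ x))) h) * F (Fin.suc x ∷ h)))
      ≈⟨ +-cong (∑-increasingFrom-suc n 0 _) (∑-cong (allFin K) (λ x → ∑-increasingFrom-suc n (suc (toℕ x)) _)) ⟩
    ∑ (allVecs (allFin K) n) (λ h → 𝟙 (increasingFrom 0 h) * F (Fin.zero ∷ Vec.map Fin.suc h)) +
    ∑ (allFin K) (λ x → ∑ (allVecs (allFin K) n) (λ h → 𝟙 (increasingFrom (suc (toℕ x)) h) * F (Fin.suc x ∷ Vec.map Fin.suc h)))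
      ≈⟨ +-cong (sym (∑-Kset≈∑-increasingFrom (λ h → F (Fin.zero ∷ Vec.map Fin.suc h))))
                (trans (sym (∑-allVecs-suc (allFin K) n _)) (sym (∑-Kset≈∑-increasingFrom (F ∘ Vec.map Fin.suc)))) ⟩
    ∑ (Kset K n) (λ h → F (Fin.zero ∷ Vec.map Fin.suc h)) + ∑ (Kset K (suc n)) (F ∘ Vec.map Fin.suc) ∎

  VanishesOnRepeats : ∀ {K n} → (Fin K → Vec (Fin K) n → Carrier) → Set ℓ
  VanishesOnRepeats F = ∀ x h → memFin x h ≡ true → F x h ≈ 0#

  insertions : ∀ {K n} → (Fin K → Vec (Fin K) n → Carrier) → Vec (Fin K) (suc n) → Carrier
  insertions {n = n} F k = ∑ (allFin (suc n)) (λ i → F (lookup k i) (removeAt k i))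

  shiftVanishing : ∀ {K n} (F : Fin (suc K) → Vec (Fin (suc K)) n → Carrier) → VanishesOnRepeats F →
    VanishesOnRepeats (λ x h → F (Fin.suc x) (Vec.map Fin.suc h))
  shiftVanishing F vanish x h x∈h = vanish _ _ (P.trans (memFin-suc x h) x∈h)

  insertions-zero∷suc : ∀ {K m} (F : Fin (suc K) → Vec (Fin (suc K)) (suc m) → Carrier) (h : Vec (Fin K) (suc m)) →
    insertions F (Fin.zero ∷ Vec.map Fin.suc h) ≈
    F Fin.zero (Vec.map Fin.suc h) + insertions (λ x h′ → F (Fin.suc x) (Fin.zero ∷ Vec.map Fin.suc h′)) h
  insertions-zero∷suc {m = m} F (h₀ ∷ h) = trans (reflexive (∑-allFin-suc (suc m) _)) (+-congˡ (∑-cong (allFin (suc m)) (λ j →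
    reflexive (P.cong₂ F (VecP.lookup-map j Fin.suc (h₀ ∷ h)) (P.cong (Fin.zero ∷_) (removeAt-map Fin.suc (h₀ ∷ h) j))))))

  -- An increasing k with a marked position i is the same as an increasing h = removeAt k i
  -- together with an entry x = lookup k i not in h.
  ∑-Kset-insert : ∀ K n (F : Fin K → Vec (Fin K) n → Carrier) → VanishesOnRepeats F →
    ∑ (Kset K (suc n)) (insertions F) ≈ ∑ (allFin K) (λ x → ∑ (Kset K n) (F x))

  ∑-Kset-insert-step : ∀ K n (F : Fin (suc K) → Vec (Fin (suc K)) n → Carrier) → VanishesOnRepeats F →
    ∑ (Kset K n) (λ h → insertions F (Fin.zero ∷ Vec.map Fin.suc h)) +
    ∑ (allFin K) (λ x → ∑ (Kset K n) (λ h → F (Fin.suc x) (Vec.map Fin.suc h)))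
    ≈ ∑ (allFin (suc K)) (λ x → ∑ (Kset (suc K) n) (F x))
  ∑-Kset-insert-step K zero F vanish = trans (+-congʳ (+-identityʳ _)) (reflexive (P.sym (∑-allFin-suc K _)))
  ∑-Kset-insert-step K (suc m) F vanish = begin
    ∑ (Kset K (suc m)) (λ h → insertions F (Fin.zero ∷ Vec.map Fin.suc h)) + C
      ≈⟨ +-congʳ (trans (∑-cong (Kset K (suc m)) (insertions-zero∷suc F)) (∑-distrib-+ (Kset K (suc m)) _ _)) ⟩
    (A + ∑ (Kset K (suc m)) (insertions (λ x h → F (Fin.suc x) (Fin.zero ∷ Vec.map Fin.suc h)))) + C
      ≈⟨ +-congʳ (+-congˡ (∑-Kset-insert K m _ (λ x h x∈h → vanish _ _ (P.trans (memFin-suc x h) x∈h)))) ⟩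
    (A + B) + C
      ≈⟨ +-assoc _ _ _ ⟩
    A + (B + C)
      ≈⟨ +-cong (sym (+-identityˡ _)) (sym (∑-distrib-+ (allFin K) _ _)) ⟩
    (0# + A) + ∑ (allFin K) (λ x → ∑ (Kset K m) (λ h → F (Fin.suc x) (Fin.zero ∷ Vec.map Fin.suc h)) +
                                    ∑ (Kset K (suc m)) (λ h → F (Fin.suc x) (Vec.map Fin.suc h)))
      ≈⟨ +-cong (+-congʳ (sym (∑-zero (Kset K m) (λ h → vanish Fin.zero _ P.refl))))
                (∑-cong (allFin K) (λ x → sym (∑-Kset-split (F (Fin.suc x))))) ⟩
    (∑ (Kset K m) (λ h → F Fin.zero (Fin.zero ∷ Vec.map Fin.suc h)) + A) +
    ∑ (allFin K) (λ x → ∑ (Kset (suc K) (suc m)) (F (Fin.suc x)))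
      ≈⟨ +-congʳ (sym (∑-Kset-split (F Fin.zero))) ⟩
    ∑ (Kset (suc K) (suc m)) (F Fin.zero) + ∑ (allFin K) (λ x → ∑ (Kset (suc K) (suc m)) (F (Fin.suc x)))
      ≡⟨ ∑-allFin-suc K _ ⟨
    ∑ (allFin (suc K)) (λ x → ∑ (Kset (suc K) (suc m)) (F x)) ∎
    where
    A = ∑ (Kset K (suc m)) (λ h → F Fin.zero (Vec.map Fin.suc h))
    B = ∑ (allFin K) (λ x → ∑ (Kset K m) (λ h → F (Fin.suc x) (Fin.zero ∷ Vec.map Fin.suc h)))
    C = ∑ (allFin K) (λ x → ∑ (Kset K (suc m)) (λ h → F (Fin.suc x) (Vec.map Fin.suc h)))

  ∑-Kset-insert zero n F vanish = refl
  ∑-Kset-insert (suc K) n F vanish = begin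
    ∑ (Kset (suc K) (suc n)) (insertions F)
      ≈⟨ ∑-Kset-split (insertions F) ⟩
    ∑ (Kset K n) (λ h → insertions F (Fin.zero ∷ Vec.map Fin.suc h)) + ∑ (Kset K (suc n)) (insertions F ∘ Vec.map Fin.suc)
      ≈⟨ +-congˡ (trans (∑-cong (Kset K (suc n)) insertions-suc) (∑-Kset-insert K n _ (shiftVanishing F vanish))) ⟩
    ∑ (Kset K n) (λ h → insertions F (Fin.zero ∷ Vec.map Fin.suc h)) +
    ∑ (allFin K) (λ x → ∑ (Kset K n) (λ h → F (Fin.suc x) (Vec.map Fin.suc h)))
      ≈⟨ ∑-Kset-insert-step K n F vanish ⟩
    ∑ (allFin (suc K)) (λ x → ∑ (Kset (suc K) n) (F x)) ∎
    where
    insertions-suc : ∀ k → insertions F (Vec.map Fin.suc k) ≈ insertions (λ x h → F (Fin.suc x) (Vec.map Fin.suc h)) k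
    insertions-suc k = ∑-cong (allFin (suc n)) (λ i →
      reflexive (P.cong₂ F (VecP.lookup-map i Fin.suc k) (removeAt-map Fin.suc k i)))

  Alternating : ∀ {A : Set} {n} → (Vec A n → Carrier) → Set ℓ
  Alternating {n = zero} G = Level.Lift ℓ ⊤
  Alternating {n = suc n} G = (∀ a v → G (swapAt a v) ≈ - G v) × (∀ a v → RepeatsAt a v → G v ≈ 0#)

  alternating-tail : ∀ {A : Set} {n} (G : Vec A (suc n) → Carrier) → Alternating G → ∀ x → Alternating (G ∘ (x ∷_))
  alternating-tail {n = zero} G _ x = Level.lift tt
  alternating-tail {n = suc n} G (anti , rep) x = (λ a v → anti (Fin.suc a) (x ∷ v)) , (λ a v → rep (Fin.suc a) (x ∷ v))

  antisymmetric-move-to-front : ∀ {A : Set} {n} (G : Vec A (suc n) → Carrier) → (∀ a v → G (swapAt a v) ≈ - G v) →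
    ∀ i v → G v ≈ sign (toℕ i) * G (lookup v i ∷ removeAt v i)
  antisymmetric-move-to-front G anti Fin.zero (x ∷ w) = sym (*-identityˡ _)
  antisymmetric-move-to-front {n = suc m} G anti (Fin.suc j) (x ∷ y ∷ w) = begin
    G (x ∷ y ∷ w)
      ≈⟨ antisymmetric-move-to-front (G ∘ (x ∷_)) (λ a v → anti (Fin.suc a) (x ∷ v)) j (y ∷ w) ⟩
    sign (toℕ j) * G (x ∷ z ∷ rest)
      ≈⟨ *-congˡ (anti Fin.zero (z ∷ x ∷ rest)) ⟩
    sign (toℕ j) * - G (z ∷ x ∷ rest)
      ≈⟨ -‿distribʳ-* _ _ ⟨
    - (sign (toℕ j) * G (z ∷ x ∷ rest))
      ≈⟨ -‿distribˡ-* _ _ ⟩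
    - sign (toℕ j) * G (z ∷ x ∷ rest)
      ≈⟨ *-congʳ (sign-suc (toℕ j)) ⟨
    sign (suc (toℕ j)) * G (z ∷ x ∷ rest) ∎
    where
    z = lookup (y ∷ w) j
    rest = removeAt (y ∷ w) j

  alternating-memFin : ∀ {K n} (G : Vec (Fin K) (suc n) → Carrier) → Alternating G → ∀ x h → memFin x h ≡ true → G (x ∷ h) ≈ 0#
  alternating-memFin {n = zero} G _ x [] ()
  alternating-memFin {n = suc m} G (anti , rep) x h x∈h with memFin⇒∃ x h x∈h
  ... | α , hα≡x = begin
    G (x ∷ h)
      ≈⟨ antisymmetric-move-to-front (G ∘ (x ∷_)) (λ a v → anti (Fin.suc a) (x ∷ v)) α h ⟩
    sign (toℕ α) * G (x ∷ lookup h α ∷ removeAt h α)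
      ≈⟨ *-congˡ (rep Fin.zero _ (P.sym hα≡x)) ⟩
    sign (toℕ α) * 0#
      ≈⟨ zeroʳ _ ⟩
    0# ∎

  cauchy-binet : ∀ {K} n (Q G : Vec (Fin K) n → Carrier) → Alternating G →
    ∑ (allVecs (allFin K) n) (λ f → Q f * G f) ≈ ∑ (Kset K n) (λ k → alt Q k * G k)
  cauchy-binet zero Q G _ = +-congʳ (*-congʳ (sym (trans (+-identityʳ _) (trans (*-congʳ (*-identityˡ _)) (*-identityˡ _)))))
  cauchy-binet {K} (suc m) Q G al = begin
    ∑ (allVecs (allFin K) (suc m)) (λ f → Q f * G f)
      ≈⟨ ∑-allVecs-suc (allFin K) m _ ⟩
    ∑ (allFin K) (λ x → ∑ (allVecs (allFin K) m) (λ h → Q (x ∷ h) * G (x ∷ h)))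
      ≈⟨ ∑-cong (allFin K) (λ x → cauchy-binet m (Q ∘ (x ∷_)) (G ∘ (x ∷_)) (alternating-tail G al x)) ⟩
    ∑ (allFin K) (λ x → ∑ (Kset K m) (expand x))
      ≈⟨ ∑-Kset-insert K m expand (λ x h x∈h → *-≈0ʳ _ (alternating-memFin G al x h x∈h)) ⟨
    ∑ (Kset K (suc m)) (insertions expand)
      ≈⟨ ∑-cong (Kset K (suc m)) (λ k → sym (laplace k)) ⟩
    ∑ (Kset K (suc m)) (λ k → alt Q k * G k) ∎
    where
    expand : Fin K → Vec (Fin K) m → Carrier
    expand x h = alt (Q ∘ (x ∷_)) h * G (x ∷ h)
    laplace : ∀ k → alt Q k * G k ≈ insertions expand k
    laplace k = begin
      alt Q k * G k
        ≈⟨ trans (*-congʳ (alt-laplace Q k)) (*-distribʳ-∑ (allFin (suc m)) _ _) ⟩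
      ∑ (allFin (suc m)) (λ i → (sign (toℕ i) * alt (Q ∘ (lookup k i ∷_)) (removeAt k i)) * G k)
        ≈⟨ ∑-cong (allFin (suc m)) (λ i → *-congˡ (antisymmetric-move-to-front G (proj₁ al) i k)) ⟩
      ∑ (allFin (suc m)) (λ i → (sign (toℕ i) * alt (Q ∘ (lookup k i ∷_)) (removeAt k i)) *
                                 (sign (toℕ i) * G (lookup k i ∷ removeAt k i)))
        ≈⟨ ∑-cong (allFin (suc m)) (λ i → trans (*-interchange _ _ _ _) (trans (*-congʳ (sign²≈1 (toℕ i))) (*-identityˡ _))) ⟩
      insertions expand k ∎

  det-alternating : ∀ {B : Set} {N} (H : Fin N → B → Carrier) → Alternating (det H)
  det-alternating {N = zero} H = Level.lift tt
  det-alternating {N = suc n} H = det-swapAt H , det-repeats H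

parOf-suc : ∀ x → parOf (suc x) ≡ flipP (parOf x)
parOf-suc zero = P.refl
parOf-suc (suc zero) = P.refl
parOf-suc (suc (suc x)) = parOf-suc x

flipP-involutive : ∀ q → flipP (flipP q) ≡ q
flipP-involutive e = P.refl
flipP-involutive o = P.refl

flipP-injective : ∀ {p q} → flipP p ≡ flipP q → p ≡ q
flipP-injective {p} {q} eq = P.trans (P.sym (flipP-involutive p)) (P.trans (P.cong flipP eq) (flipP-involutive q))

==P-refl : ∀ q → (q ==P q) ≡ true
==P-refl e = P.refl
==P-refl o = P.refl

∣-∣≡1⇒neighbour : ∀ x y → ∣ x - y ∣ ≡ 1 → y ≡ suc x ⊎ x ≡ suc y
∣-∣≡1⇒neighbour zero y eq = inj₁ eq
∣-∣≡1⇒neighbour (suc x) zero eq = inj₂ eq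
∣-∣≡1⇒neighbour (suc x) (suc y) eq with ∣-∣≡1⇒neighbour x y eq
... | inj₁ up = inj₁ (P.cong suc up)
... | inj₂ down = inj₂ (P.cong suc down)

∣-∣≡1⇒≤suc : ∀ x y → ∣ x - y ∣ ≡ 1 → y ≤ suc x × x ≤ suc y
∣-∣≡1⇒≤suc x y d with ∣-∣≡1⇒neighbour x y d
... | inj₁ P.refl = ℕP.≤-refl , ℕP.m≤n⇒m≤1+n (ℕP.n≤1+n x)
... | inj₂ P.refl = ℕP.m≤n⇒m≤1+n (ℕP.n≤1+n y) , ℕP.≤-refl

parOf-step : ∀ x y q → parOf x ≡ flipP q → ∣ x - y ∣ ≡ 1 → parOf y ≡ q
parOf-step x y q px d with ∣-∣≡1⇒neighbour x y d
... | inj₁ P.refl = P.trans (parOf-suc x) (P.trans (P.cong flipP px) (flipP-involutive q))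
... | inj₂ P.refl = flipP-injective (P.trans (P.sym (parOf-suc y)) px)

parOf-gap : ∀ x y → parOf x ≡ parOf y → x < y → suc (suc x) ≤ y
parOf-gap zero (suc zero) () _
parOf-gap zero (suc (suc y)) _ _ = s≤s (s≤s z≤n)
parOf-gap (suc zero) (suc zero) _ (s≤s ())
parOf-gap (suc zero) (suc (suc zero)) () _
parOf-gap (suc zero) (suc (suc (suc y))) _ _ = s≤s (s≤s (s≤s z≤n))
parOf-gap (suc (suc x)) (suc (suc y)) eq (s≤s (s≤s x<y)) = s≤s (s≤s (parOf-gap x y eq x<y))

-- Same-parity entries of a are at distance at least 2, so after one ±1 move the entries of c
-- are still weakly increasing and strict increase can only fail by two equal neighbours.
step-collision : ∀ {n} (a c : Vec ℕ (suc n)) (p : Par) → Increasing a → (∀ j → parOf (lookup a j) ≡ p) →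
  (∀ j → ∣ lookup a j - lookup c j ∣ ≡ 1) → strictIncℕ c ≡ false → ∃ λ i → RepeatsAt i c
step-collision (a₀ ∷ []) (c₀ ∷ []) p _ _ _ ()
step-collision (a₀ ∷ a₁ ∷ a) (c₀ ∷ c₁ ∷ c) p (a₀<a₁ , inc) par step notInc with true-or-false (c₀ <ᵇ c₁)
... | inj₁ c₀<c₁ = let i , r = step-collision (a₁ ∷ a) (c₁ ∷ c) p inc (par ∘ Fin.suc) (step ∘ Fin.suc)
                                 (P.trans (P.cong (_∧ strictIncℕ (c₁ ∷ c)) (P.sym c₀<c₁)) notInc)
                   in Fin.suc i , r
... | inj₂ c₀≮c₁ = Fin.zero , ℕP.≤-antisym c₀≤c₁ c₁≤c₀
  where
  c₀≤c₁ : c₀ ≤ c₁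
  c₀≤c₁ = ℕP.≤-trans (proj₁ (∣-∣≡1⇒≤suc a₀ c₀ (step Fin.zero)))
            (ℕP.≤-pred (ℕP.≤-trans (parOf-gap a₀ a₁ (P.trans (par Fin.zero) (P.sym (par (Fin.suc Fin.zero)))) a₀<a₁)
                                   (proj₂ (∣-∣≡1⇒≤suc a₁ c₁ (step (Fin.suc Fin.zero))))))
  c₁≤c₀ : c₁ ≤ c₀
  c₁≤c₀ = ℕP.≮⇒≥ (λ c₀<c₁ → P.subst T c₀≮c₁ (ℕP.<⇒<ᵇ c₀<c₁))

module Conjugation {c ℓ} (R : CommutativeRing c ℓ) (cj : Conj R) where
  open CommutativeRing R
  open ListSums R
  open Signs R
  open Conj cj

  conj-0# : conj 0# ≈ 0#
  conj-0# = x+x≈x⇒x≈0 (conj 0#) (sym (trans (conj-cong (sym (+-identityʳ 0#))) (conj-+ 0# 0#)))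

  conj-‿ : ∀ x → conj (- x) ≈ - conj x
  conj-‿ x = +-inverseʳ-unique (conj x) (conj (- x)) (trans (sym (conj-+ x (- x))) (trans (conj-cong (-‿inverseʳ x)) conj-0#))

  conj-∑ : ∀ {A : Set} (xs : List A) (f : A → Carrier) → conj (∑ xs f) ≈ ∑ xs (conj ∘ f)
  conj-∑ [] f = conj-0#
  conj-∑ (x ∷ xs) f = trans (conj-+ _ _) (+-congˡ (conj-∑ xs f))

  conj-∏ : ∀ {A : Set} (xs : List A) (f : A → Carrier) → conj (∏ xs f) ≈ ∏ xs (conj ∘ f)
  conj-∏ [] f = conj-1
  conj-∏ (x ∷ xs) f = trans (conj-* _ _) (*-congˡ (conj-∏ xs f))

  conj-sign : ∀ n → conj (sign n) ≈ sign n
  conj-sign n with isEven n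
  ... | true = conj-1
  ... | false = trans (conj-‿ 1#) (-‿cong conj-1)

  conj-Edet : ∀ {K N} (C : Fin K → ℕ → Carrier) (k : Vec (Fin K) N) (y : Vec ℕ N) →
    conj (Edet R C k y) ≈ Edet R (λ j z → conj (C j z)) k y
  conj-Edet {N = N} C k y = trans (conj-∑ (perms N) _)
    (∑-cong (perms N) (λ σ → trans (conj-* _ _) (*-cong (conj-sign (inversions σ)) (conj-∏ (allFin N) _))))

module Completeness {c ℓ} (R : CommutativeRing c ℓ) (cj : Conj R) {L : ℕ} {w : ℕ → ℕ → CommutativeRing.Carrier R} {K : ℕ}
                    (sd : Spectral R cj L w K) where
  open CommutativeRing R
  open ListSums R
  open VecSums R
  open Signs R
  open Determinants R
  open CauchyBinet R
  open Conjugation R cj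
  open Conj cj
  open Spectral sd
  open import Relation.Binary.Reasoning.Setoid setoid

  module _ (p : Par) where

    L̄ : Fin K → ℕ → Carrier
    L̄ j y = conj (Lv p j y)

    ∑-Rv-L̄ : ∀ {N} (c b : Vec ℕ N) → InU p L c → InU p L b → ∀ (ρ : Vec (Fin N) N) →
      ∑ (allVecs (allFin K) N) (λ f → zipProd (Rv p) f c * zipProd (λ γ j → L̄ j (lookup b γ)) ρ f) ≈
      𝟙 (eqVec c (Vec.map (lookup b) ρ))
    ∑-Rv-L̄ {N} c b uc ub ρ = begin
      ∑ (allVecs (allFin K) N) (λ f → zipProd (Rv p) f c * zipProd (λ γ j → L̄ j (lookup b γ)) ρ f)
        ≈⟨ ∑-cong (allVecs (allFin K) N) (λ f → trans (*-cong (sym (zipProd≈∏ (Rv p) f c)) (sym (zipProd≈∏ _ ρ f)))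
                                                       (sym (∏-distrib-* (allFin N) _ _))) ⟩
      ∑ (allVecs (allFin K) N) (λ f → ∏ (allFin N) (λ α → Rv p (lookup f α) (lookup c α) * L̄ (lookup f α) (lookup b (lookup ρ α))))
        ≈⟨ ∑∏≈∏∑ (allFin K) N (λ α j → Rv p j (lookup c α) * L̄ j (lookup b (lookup ρ α))) ⟩
      ∏ (allFin N) (λ α → ∑ (allFin K) (λ j → Rv p j (lookup c α) * L̄ j (lookup b (lookup ρ α))))
        ≈⟨ ∏-cong (allFin N) (λ α → complete p _ _ (proj₂ uc α) (proj₂ ub (lookup ρ α))) ⟩
      ∏ (allFin N) (λ α → 𝟙 (lookup c α ≡ᵇ lookup b (lookup ρ α)))
        ≈⟨ ∏-cong (allFin N) (λ α → reflexive (P.cong (λ z → 𝟙 (lookup c α ≡ᵇ z)) (P.sym (VecP.lookup-map α (lookup b) ρ)))) ⟩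
      ∏ (allFin N) (λ α → 𝟙 (lookup c α ≡ᵇ lookup (Vec.map (lookup b) ρ) α))
        ≈⟨ zipProd≈∏ (λ x y → 𝟙 (x ≡ᵇ y)) c _ ⟩
      zipProd (λ x y → 𝟙 (x ≡ᵇ y)) c (Vec.map (lookup b) ρ)
        ≈⟨ zipProd-≡ᵇ c _ ⟩
      𝟙 (eqVec c (Vec.map (lookup b) ρ)) ∎

    Edet-completeness : ∀ {N} (c b : Vec ℕ N) → InU p L c → InU p L b →
      ∑ (Kset K N) (λ k → Edet R (Rv p) k c * conj (Edet R (Lv p) k b)) ≈ 𝟙 (eqVec c b)
    Edet-completeness {N} c b uc ub = begin
      ∑ (Kset K N) (λ k → Edet R (Rv p) k c * conj (Edet R (Lv p) k b))
        ≈⟨ ∑-cong (Kset K N) (λ k → *-cong (Edet≈alt (Rv p) k c) (trans (conj-Edet (Lv p) k b) (Edet≈det-transposed L̄ k b))) ⟩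
      ∑ (Kset K N) (λ k → alt Q k * det H k)
        ≈⟨ cauchy-binet N Q (det H) (det-alternating H) ⟨
      ∑ words (λ f → Q f * det H f)
        ≈⟨ ∑-cong words (λ f → trans (*-distribˡ-∑ maps _ _) (∑-cong maps (λ ρ → x*yz≈y*xz _ _ _))) ⟩
      ∑ words (λ f → ∑ maps (λ ρ → ε ρ * (Q f * zipProd H ρ f)))
        ≈⟨ ∑-comm words maps _ ⟩
      ∑ maps (λ ρ → ∑ words (λ f → ε ρ * (Q f * zipProd H ρ f)))
        ≈⟨ ∑-cong maps (λ ρ → trans (sym (*-distribˡ-∑ words _ _)) (*-congˡ (∑-Rv-L̄ c b uc ub ρ))) ⟩
      ∑ maps (λ ρ → ε ρ * 𝟙 (eqVec c (Vec.map (lookup b) ρ)))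
        ≈⟨ ∑-cong maps (ε-𝟙-eqVec-permuted c b (strictIncℕ⇒Increasing c (proj₁ uc)) (strictIncℕ⇒Increasing b (proj₁ ub))) ⟩
      ∑ maps (λ ρ → 𝟙 (eqFinVec ρ identity) * 𝟙 (eqVec c b))
        ≈⟨ ∑-𝟙-eqFinVec N identity (λ _ → 𝟙 (eqVec c b)) ⟩
      𝟙 (eqVec c b) ∎
      where
      words = allVecs (allFin K) N
      maps = allVecs (allFin N) N
      Q : Vec (Fin K) N → Carrier
      Q f = zipProd (Rv p) f c
      H : Fin N → Fin K → Carrier
      H γ j = L̄ j (lookup b γ)

allᵇ-unique : ∀ {A : Set} (f : A → Bool) (g : List A → Bool) → g [] ≡ true → (∀ x xs → g (x ∷ xs) ≡ (f x ∧ g xs)) →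
  ∀ xs → g xs ≡ allᵇ f xs
allᵇ-unique f g g[] g∷ [] = g[]
allᵇ-unique f g g[] g∷ (x ∷ xs) = P.trans (g∷ x xs) (P.cong (f x ∧_) (allᵇ-unique f g g[] g∷ xs))

isStep : ∀ {N} → Vec ℕ N → Vec ℕ N → Bool
isStep {N} a c = allᵇ (λ j → ∣ lookup a j - lookup c j ∣ ≡ᵇ 1) (allFin N)

isStep⇒∣-∣≡1 : ∀ {N} (a c : Vec ℕ N) → isStep a c ≡ true → ∀ j → ∣ lookup a j - lookup c j ∣ ≡ 1
isStep⇒∣-∣≡1 {N} a c step j = ≡ᵇ⇒≡ _ _ (all-true⇒∈ _ (allFin N) step (∈-allFin j))

module Paths {c ℓ} (R : CommutativeRing c ℓ) (L : ℕ) (w : ℕ → ℕ → CommutativeRing.Carrier R) where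
  open CommutativeRing R
  open ListSums R
  open VecSums R
  open import Relation.Binary.Reasoning.Setoid setoid

  -- stepsOK conjoins the coordinate tests with a list conjunction local to Defs; it is
  -- identified with allᵇ through its defining equations.
  stepsOK-∷∷ : ∀ {N t} (y y' : Vec ℕ N) (ys : Vec (Vec ℕ N) t) →
    stepsOK R (y ∷ y' ∷ ys) ≡ (isStep y y' ∧ stepsOK R (y' ∷ ys))
  stepsOK-∷∷ {N} y y' ys with allFin N | allᵇ-unique (λ j → ∣ lookup y j - lookup y' j ∣ ≡ᵇ 1) _ P.refl (λ _ _ → P.refl)
  ... | js | local≡allᵇ = P.cong (_∧ stepsOK R (y' ∷ ys)) (local≡allᵇ js)

  stepWeight : ∀ {N} → Vec ℕ N → Vec ℕ N → Carrier
  stepWeight {N} a c = ∏ (allFin N) (λ j → w (lookup a j) (lookup c j))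

  ∑-configs : ∀ {N} (F : Vec ℕ N → Carrier) → ∑ (configs N L) F ≈ ∑ (allVecs (upTo (suc L)) N) (λ c → 𝟙 (strictIncℕ c) * F c)
  ∑-configs {N} F = ∑-filterᵇ strictIncℕ (allVecs (upTo (suc L)) N) F

  pathWeight : ∀ {N t} → Vec ℕ N → Vec (Vec ℕ N) t → Vec ℕ N → Carrier
  pathWeight a rest b = 𝟙 (eqVec (lastV R (a ∷ rest)) b ∧ stepsOK R (a ∷ rest)) * stepW R w (a ∷ rest)

  pathSum : ∀ {N} (t : ℕ) → Vec ℕ N → Vec ℕ N → Carrier
  pathSum {N} t a b = ∑ (allVecs (configs N L) t) (λ rest → pathWeight a rest b)

  pathSum-zero : ∀ {N} (a b : Vec ℕ N) → pathSum 0 a b ≈ 𝟙 (eqVec a b)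
  pathSum-zero a b = trans (+-identityʳ _) (trans (*-identityʳ _) (reflexive (P.cong 𝟙 (BoolP.∧-identityʳ (eqVec a b)))))

  pathWeight-∷ : ∀ {N t} (a c : Vec ℕ N) (r : Vec (Vec ℕ N) t) (b : Vec ℕ N) →
    pathWeight a (c ∷ r) b ≈ 𝟙 (isStep a c) * (stepWeight a c * pathWeight c r b)
  pathWeight-∷ a c r b rewrite stepsOK-∷∷ a c r = begin
    𝟙 (end ∧ (step ∧ later)) * (W * V)     ≈⟨ *-congʳ (trans (𝟙-∧ end _) (*-congˡ (𝟙-∧ step later))) ⟩
    (𝟙 end * (𝟙 step * 𝟙 later)) * (W * V) ≈⟨ *-congʳ (x*yz≈y*xz _ _ _) ⟩
    (𝟙 step * (𝟙 end * 𝟙 later)) * (W * V) ≈⟨ *-assoc _ _ _ ⟩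
    𝟙 step * ((𝟙 end * 𝟙 later) * (W * V)) ≈⟨ *-congˡ (x*yz≈y*xz _ _ _) ⟩
    𝟙 step * (W * ((𝟙 end * 𝟙 later) * V)) ≈⟨ *-congˡ (*-congˡ (*-congʳ (𝟙-∧ end later))) ⟨
    𝟙 step * (W * (𝟙 (end ∧ later) * V))   ∎
    where
    end = eqVec (lastV R (c ∷ r)) b
    step = isStep a c
    later = stepsOK R (c ∷ r)
    W = stepWeight a c
    V = stepW R w (c ∷ r)

  pathSum-suc : ∀ {N} t (a b : Vec ℕ N) →
    pathSum (suc t) a b ≈ ∑ (configs N L) (λ c → 𝟙 (isStep a c) * (stepWeight a c * pathSum t c b))
  pathSum-suc {N} t a b = begin
    pathSum (suc t) a b
      ≈⟨ ∑-allVecs-suc (configs N L) t _ ⟩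
    ∑ (configs N L) (λ c → ∑ rests (λ r → pathWeight a (c ∷ r) b))
      ≈⟨ ∑-cong (configs N L) (λ c → ∑-cong rests (λ r → pathWeight-∷ a c r b)) ⟩
    ∑ (configs N L) (λ c → ∑ rests (λ r → 𝟙 (isStep a c) * (stepWeight a c * pathWeight c r b)))
      ≈⟨ ∑-cong (configs N L) (λ c → trans (sym (*-distribˡ-∑ rests _ _)) (*-congˡ (sym (*-distribˡ-∑ rests _ _)))) ⟩
    ∑ (configs N L) (λ c → 𝟙 (isStep a c) * (stepWeight a c * pathSum t c b)) ∎
    where rests = allVecs (configs N L) t

  ∑-configs-𝟙-eqVec : ∀ {N} (p : Par) (a : Vec ℕ N) → InU p L a → (X : Vec ℕ N → Carrier) →
    ∑ (configs N L) (λ c → 𝟙 (eqVec c a) * X c) ≈ X a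
  ∑-configs-𝟙-eqVec {N} p a ua X = begin
    ∑ (configs N L) (λ c → 𝟙 (eqVec c a) * X c)
      ≈⟨ ∑-configs {N} _ ⟩
    ∑ (allVecs (upTo (suc L)) N) (λ c → 𝟙 (strictIncℕ c) * (𝟙 (eqVec c a) * X c))
      ≈⟨ ∑-cong (allVecs (upTo (suc L)) N) (λ c → trans (x*yz≈y*xz _ _ _)
           (reflexive (P.cong (λ z → 𝟙 z * (𝟙 (strictIncℕ c) * X c)) (eqVec≡eqVecBy c a)))) ⟩
    ∑ (allVecs (upTo (suc L)) N) (λ c → 𝟙 (eqVecBy _≡ᵇ_ c a) * (𝟙 (strictIncℕ c) * X c))
      ≈⟨ ∑-allVecs-𝟙-eq (upTo (suc L)) _≡ᵇ_ N a (λ α f → ∑-𝟙-upTo (suc L) (lookup a α) f (s≤s (proj₁ (proj₂ ua α)))) _ ⟩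
    𝟙 (strictIncℕ a) * X a
      ≈⟨ trans (*-congʳ (𝟙-true (proj₁ ua))) (*-identityˡ _) ⟩
    X a ∎

  Z≈V*pathSum : ∀ {N} (v : ℕ → Carrier) t (p : Par) (a b : Vec ℕ N) → InU p L a →
    Z R L N w v t a b ≈ Vw R v a * pathSum t a b
  Z≈V*pathSum {N} v t p a b ua = begin
    Z R L N w v t a b
      ≈⟨ ∑-allVecs-suc (configs N L) t _ ⟩
    ∑ (configs N L) (λ c → ∑ rests (λ r → 𝟙 (eqVec c a ∧ (eqVec (lastV R (c ∷ r)) b ∧ stepsOK R (c ∷ r))) *
                                           (Vw R v c * stepW R w (c ∷ r))))
      ≈⟨ ∑-cong (configs N L) (λ c → ∑-cong rests (λ r →
           trans (*-congʳ (𝟙-∧ _ _)) (trans (*-assoc _ _ _) (*-congˡ (x*yz≈y*xz _ _ _))))) ⟩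
    ∑ (configs N L) (λ c → ∑ rests (λ r → 𝟙 (eqVec c a) * (Vw R v c * pathWeight c r b)))
      ≈⟨ ∑-cong (configs N L) (λ c → trans (sym (*-distribˡ-∑ rests _ _)) (*-congˡ (sym (*-distribˡ-∑ rests _ _)))) ⟩
    ∑ (configs N L) (λ c → 𝟙 (eqVec c a) * (Vw R v c * pathSum t c b))
      ≈⟨ ∑-configs-𝟙-eqVec p a ua (λ c → Vw R v c * pathSum t c b) ⟩
    Vw R v a * pathSum t a b ∎
    where rests = allVecs (configs N L) t

  ∑-steps-cong : ∀ {N} (q : Par) (a : Vec ℕ N) → InU (flipP q) L a → {F G : Vec ℕ N → Carrier} →
    (∀ c → InU q L c → F c ≈ G c) →
    ∑ (configs N L) (λ c → 𝟙 (isStep a c) * (stepWeight a c * F c)) ≈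
    ∑ (configs N L) (λ c → 𝟙 (isStep a c) * (stepWeight a c * G c))
  ∑-steps-cong {N} q a ua {F} {G} F≈G = begin
    ∑ (configs N L) (λ c → 𝟙 (isStep a c) * (stepWeight a c * F c))
      ≈⟨ ∑-configs {N} _ ⟩
    ∑ (allVecs (upTo (suc L)) N) (λ c → 𝟙 (strictIncℕ c) * (𝟙 (isStep a c) * (stepWeight a c * F c)))
      ≈⟨ ∑-allVecs-cong-∈ (upTo (suc L)) N termwise ⟩
    ∑ (allVecs (upTo (suc L)) N) (λ c → 𝟙 (strictIncℕ c) * (𝟙 (isStep a c) * (stepWeight a c * G c)))
      ≈⟨ ∑-configs {N} _ ⟨
    ∑ (configs N L) (λ c → 𝟙 (isStep a c) * (stepWeight a c * G c)) ∎
    where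
    termwise : ∀ c → (∀ α → lookup c α ∈ upTo (suc L)) →
      𝟙 (strictIncℕ c) * (𝟙 (isStep a c) * (stepWeight a c * F c)) ≈ 𝟙 (strictIncℕ c) * (𝟙 (isStep a c) * (stepWeight a c * G c))
    termwise c c∈ with true-or-false (strictIncℕ c) | true-or-false (isStep a c)
    ... | inj₂ notInc | _ = both-zero (*-≈0ˡ _ (𝟙-false notInc)) (*-≈0ˡ _ (𝟙-false notInc))
    ... | inj₁ _ | inj₂ noStep = *-congˡ (both-zero (*-≈0ˡ _ (𝟙-false noStep)) (*-≈0ˡ _ (𝟙-false noStep)))
    ... | inj₁ inc | inj₁ step = *-congˡ (*-congˡ (*-congˡ (F≈G c (inc , λ α →
          ℕP.≤-pred (∈-upTo⁻ (c∈ α)) , parOf-step (lookup a α) (lookup c α) q (proj₂ (proj₂ ua α)) (isStep⇒∣-∣≡1 a c step α)))))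

module Transfer {c ℓ} (R : CommutativeRing c ℓ) (cj : Conj R) {L : ℕ} {w : ℕ → ℕ → CommutativeRing.Carrier R} {K : ℕ}
                (sd : Spectral R cj L w K) where
  open CommutativeRing R
  open ListSums R
  open VecSums R
  open Signs R
  open Determinants R
  open Paths R L w
  open Spectral sd
  open import Relation.Binary.Reasoning.Setoid setoid

  Tent≈𝟙*w : ∀ y y' → Tent R w y y' ≈ 𝟙 (∣ y - y' ∣ ≡ᵇ 1) * w y y'
  Tent≈𝟙*w y y' with ∣ y - y' ∣ ≡ᵇ 1
  ... | true = sym (*-identityˡ _)
  ... | false = sym (zeroˡ _)

  zipProd-Tent : ∀ {N} (a c : Vec ℕ N) → zipProd (Tent R w) a c ≈ 𝟙 (isStep a c) * stepWeight a c
  zipProd-Tent {N} a c = begin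
    zipProd (Tent R w) a c                                                       ≈⟨ zipProd≈∏ (Tent R w) a c ⟨
    ∏ (allFin N) (λ j → Tent R w (lookup a j) (lookup c j))                      ≈⟨ ∏-cong (allFin N) (λ j → Tent≈𝟙*w _ _) ⟩
    ∏ (allFin N) (λ j → 𝟙 (∣ lookup a j - lookup c j ∣ ≡ᵇ 1) * w (lookup a j) (lookup c j)) ≈⟨ ∏-distrib-* (allFin N) _ _ ⟩
    ∏ (allFin N) (λ j → 𝟙 (∣ lookup a j - lookup c j ∣ ≡ᵇ 1)) * stepWeight a c   ≈⟨ *-congʳ (∏-𝟙 (allFin N) _) ⟩
    𝟙 (isStep a c) * stepWeight a c                                              ∎

  -- R-eig is indexed by the target parity, and flipP (flipP q) does not reduce for variable q.
  R-eig-flipped : ∀ q k y → InS (flipP q) L y → ∑ (sites q L) (λ y' → Tent R w y y' * Rv q k y') ≈ lam k * Rv (flipP q) k y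
  R-eig-flipped e = R-eig o
  R-eig-flipped o = R-eig e

  Edet-collision : ∀ {N} (q : Par) (C : Fin K → ℕ → Carrier) (a c : Vec ℕ N) → InU (flipP q) L a →
    isStep a c ≡ true → strictIncℕ c ≡ false → (k : Vec (Fin K) N) → Edet R C k c ≈ 0#
  Edet-collision {zero} q C [] [] _ _ ()
  Edet-collision {suc n} q C a c ua step notInc k
    with step-collision a c (flipP q) (strictIncℕ⇒Increasing a (proj₁ ua)) (λ j → proj₂ (proj₂ ua j)) (isStep⇒∣-∣≡1 a c step) notInc
  ... | i , r = trans (Edet≈det C k c) (det-repeats (C ∘ lookup k) i c r)

  module _ (q : Par) where

    ∑-sites-eigen : ∀ {N} (a : Vec ℕ N) → (∀ α → InS (flipP q) L (lookup a α)) → (κ : Fin N → Fin K) (σ : Vec (Fin N) N) →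
      ∑ (allVecs (sites q L) N) (λ c → zipProd (Tent R w) a c * zipProd (Rv q ∘ κ) σ c) ≈
      ∏ (allFin N) (lam ∘ κ ∘ lookup σ) * zipProd (Rv (flipP q) ∘ κ) σ a
    ∑-sites-eigen {N} a a∈ κ σ = begin
      ∑ cs (λ c → zipProd (Tent R w) a c * zipProd (Rv q ∘ κ) σ c)
        ≈⟨ ∑-cong cs (λ c → trans (*-cong (sym (zipProd≈∏ _ a c)) (sym (zipProd≈∏ _ σ c))) (sym (∏-distrib-* (allFin N) _ _))) ⟩
      ∑ cs (λ c → ∏ (allFin N) (λ α → Tent R w (lookup a α) (lookup c α) * Rv q (κ (lookup σ α)) (lookup c α)))
        ≈⟨ ∑∏≈∏∑ (sites q L) N (λ α y → Tent R w (lookup a α) y * Rv q (κ (lookup σ α)) y) ⟩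
      ∏ (allFin N) (λ α → ∑ (sites q L) (λ y → Tent R w (lookup a α) y * Rv q (κ (lookup σ α)) y))
        ≈⟨ ∏-cong (allFin N) (λ α → R-eig-flipped q (κ (lookup σ α)) (lookup a α) (a∈ α)) ⟩
      ∏ (allFin N) (λ α → lam (κ (lookup σ α)) * Rv (flipP q) (κ (lookup σ α)) (lookup a α))
        ≈⟨ trans (∏-distrib-* (allFin N) _ _) (*-congˡ (zipProd≈∏ _ σ a)) ⟩
      ∏ (allFin N) (lam ∘ κ ∘ lookup σ) * zipProd (Rv (flipP q) ∘ κ) σ a ∎
      where cs = allVecs (sites q L) N

    ∑-sites-Edet : ∀ {N} (a : Vec ℕ N) → (∀ α → InS (flipP q) L (lookup a α)) → (k : Vec (Fin K) N) →
      ∑ (allVecs (sites q L) N) (λ c → zipProd (Tent R w) a c * Edet R (Rv q) k c) ≈ Lam R lam k * Edet R (Rv (flipP q)) k a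
    ∑-sites-Edet {N} a a∈ k = begin
      ∑ cs (λ c → tent a c * Edet R (Rv q) k c)
        ≈⟨ ∑-cong cs (λ c → *-congˡ (Edet≈det (Rv q) k c)) ⟩
      ∑ cs (λ c → tent a c * det Rₖ c)
        ≈⟨ ∑-cong cs (λ c → trans (*-distribˡ-∑ maps _ _) (∑-cong maps (λ σ → x*yz≈y*xz _ _ _))) ⟩
      ∑ cs (λ c → ∑ maps (λ σ → ε σ * (tent a c * zipProd Rₖ σ c)))
        ≈⟨ ∑-comm cs maps _ ⟩
      ∑ maps (λ σ → ∑ cs (λ c → ε σ * (tent a c * zipProd Rₖ σ c)))
        ≈⟨ ∑-cong maps (λ σ → trans (sym (*-distribˡ-∑ cs _ _)) (*-congˡ (∑-sites-eigen a a∈ (lookup k) σ))) ⟩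
      ∑ maps (λ σ → ε σ * (∏ (allFin N) (lam ∘ lookup k ∘ lookup σ) * zipProd R̄ₖ σ a))
        ≈⟨ ∑-cong maps eigenvalues ⟩
      ∑ maps (λ σ → Lam R lam k * (ε σ * zipProd R̄ₖ σ a))
        ≈⟨ *-distribˡ-∑ maps _ _ ⟨
      Lam R lam k * det R̄ₖ a
        ≈⟨ *-congˡ (Edet≈det (Rv (flipP q)) k a) ⟨
      Lam R lam k * Edet R (Rv (flipP q)) k a ∎
      where
      cs = allVecs (sites q L) N
      maps = allVecs (allFin N) N
      tent = zipProd (Tent R w)
      Rₖ = Rv q ∘ lookup k
      R̄ₖ = Rv (flipP q) ∘ lookup k
      eigenvalues : ∀ σ → ε σ * (∏ (allFin N) (lam ∘ lookup k ∘ lookup σ) * zipProd R̄ₖ σ a) ≈ Lam R lam k * (ε σ * zipProd R̄ₖ σ a)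
      eigenvalues σ = begin
        ε σ * (∏ (allFin N) (lam ∘ lookup k ∘ lookup σ) * zipProd R̄ₖ σ a)
          ≈⟨ *-assoc _ _ _ ⟨
        (ε σ * ∏ (allFin N) (lam ∘ lookup k ∘ lookup σ)) * zipProd R̄ₖ σ a
          ≈⟨ *-congʳ (ε-∏-permute σ (lam ∘ lookup k)) ⟩
        (ε σ * Lam R lam k) * zipProd R̄ₖ σ a
          ≈⟨ trans (*-congʳ (*-comm _ _)) (*-assoc _ _ _) ⟩
        Lam R lam k * (ε σ * zipProd R̄ₖ σ a) ∎

    hasParity : ℕ → Carrier
    hasParity y = 𝟙 (parOf y ==P q)

    ∑-hasParity : ∀ {N} (F : Vec ℕ N → Carrier) →
      ∑ (allVecs (upTo (suc L)) N) (λ c → entryProd hasParity c * F c) ≈ ∑ (allVecs (sites q L) N) F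
    ∑-hasParity {N} F = trans (∑-allVecs-weighted-map (upTo (suc L)) (sites q L) id hasParity
                                 (λ f → sym (∑-filterᵇ (λ y → parOf y ==P q) (upTo (suc L)) f)) N F)
                              (∑-cong (allVecs (sites q L) N) (λ u → reflexive (P.cong F (VecP.map-id u))))

    step-term : ∀ {N} (a : Vec ℕ N) → InU (flipP q) L a → (k : Vec (Fin K) N) → ∀ c →
      𝟙 (strictIncℕ c) * (𝟙 (isStep a c) * (stepWeight a c * Edet R (Rv q) k c)) ≈
      entryProd hasParity c * (zipProd (Tent R w) a c * Edet R (Rv q) k c)
    step-term {N} a ua k c with true-or-false (isStep a c)
    ... | inj₂ noStep = both-zero (*-≈0ʳ _ (*-≈0ˡ _ (𝟙-false noStep)))
                                  (*-≈0ʳ _ (*-≈0ˡ _ (trans (zipProd-Tent a c) (*-≈0ˡ _ (𝟙-false noStep)))))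
    ... | inj₁ step = begin
      𝟙 (strictIncℕ c) * (𝟙 (isStep a c) * (W * E))
        ≈⟨ *-congˡ (trans (*-congʳ (𝟙-true step)) (*-identityˡ _)) ⟩
      𝟙 (strictIncℕ c) * (W * E)
        ≈⟨ drop-increasing ⟩
      W * E
        ≈⟨ *-congʳ (trans (zipProd-Tent a c) (trans (*-congʳ (𝟙-true step)) (*-identityˡ _))) ⟨
      zipProd (Tent R w) a c * E
        ≈⟨ trans (*-congʳ parity-one) (*-identityˡ _) ⟨
      entryProd hasParity c * (zipProd (Tent R w) a c * E) ∎
      where
      W = stepWeight a c
      E = Edet R (Rv q) k c
      parity-one : entryProd hasParity c ≈ 1#
      parity-one = trans (entryProd≈∏ hasParity c) (∏-one (allFin N) (λ j → 𝟙-true (P.trans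
        (P.cong (_==P q) (parOf-step (lookup a j) (lookup c j) q (proj₂ (proj₂ ua j)) (isStep⇒∣-∣≡1 a c step j))) (==P-refl q))))
      drop-increasing : 𝟙 (strictIncℕ c) * (W * E) ≈ W * E
      drop-increasing with true-or-false (strictIncℕ c)
      ... | inj₁ inc = trans (*-congʳ (𝟙-true inc)) (*-identityˡ _)
      ... | inj₂ notInc = both-zero (*-≈0ˡ _ (𝟙-false notInc)) (*-≈0ʳ _ (Edet-collision q (Rv q) a c ua step notInc k))

    transfer-Edet : ∀ {N} (a : Vec ℕ N) → InU (flipP q) L a → (k : Vec (Fin K) N) →
      ∑ (configs N L) (λ c → 𝟙 (isStep a c) * (stepWeight a c * Edet R (Rv q) k c)) ≈ Lam R lam k * Edet R (Rv (flipP q)) k a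
    transfer-Edet {N} a ua k = begin
      ∑ (configs N L) (λ c → 𝟙 (isStep a c) * (stepWeight a c * Edet R (Rv q) k c))
        ≈⟨ ∑-configs {N} _ ⟩
      ∑ (allVecs (upTo (suc L)) N) (λ c → 𝟙 (strictIncℕ c) * (𝟙 (isStep a c) * (stepWeight a c * Edet R (Rv q) k c)))
        ≈⟨ ∑-cong (allVecs (upTo (suc L)) N) (step-term a ua k) ⟩
      ∑ (allVecs (upTo (suc L)) N) (λ c → entryProd hasParity c * (zipProd (Tent R w) a c * Edet R (Rv q) k c))
        ≈⟨ ∑-hasParity {N} _ ⟩
      ∑ (allVecs (sites q L) N) (λ c → zipProd (Tent R w) a c * Edet R (Rv q) k c)
        ≈⟨ ∑-sites-Edet a (proj₂ ua) k ⟩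
      Lam R lam k * Edet R (Rv (flipP q)) k a ∎

module Propagator {c ℓ} (R : CommutativeRing c ℓ) (cj : Conj R) {L : ℕ} {w : ℕ → ℕ → CommutativeRing.Carrier R} {K : ℕ}
                  (sd : Spectral R cj L w K) where
  open CommutativeRing R
  open ListSums R
  open Paths R L w
  open Completeness R cj sd
  open Transfer R cj sd
  open Conj cj
  open Spectral sd
  open import Relation.Binary.Reasoning.Setoid setoid

  spectralSum : ∀ {N} (t : ℕ) (q p : Par) → Vec ℕ N → Vec ℕ N → Carrier
  spectralSum {N} t q p a b = ∑ (Kset K N) (λ k → Edet R (Rv q) k a * pow R (Lam R lam k) t * conj (Edet R (Lv p) k b))

  pathSum≈spectralSum : ∀ {N} t (p : Par) (a b : Vec ℕ N) → InU (flipN t p) L a → InU p L b →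
    pathSum t a b ≈ spectralSum t (flipN t p) p a b
  pathSum≈spectralSum {N} zero p a b ua ub = begin
    pathSum 0 a b
      ≈⟨ pathSum-zero a b ⟩
    𝟙 (eqVec a b)
      ≈⟨ Edet-completeness p a b ua ub ⟨
    ∑ (Kset K N) (λ k → Edet R (Rv p) k a * conj (Edet R (Lv p) k b))
      ≈⟨ ∑-cong (Kset K N) (λ k → *-congʳ (*-identityʳ _)) ⟨
    spectralSum 0 p p a b ∎
  pathSum≈spectralSum {N} (suc t) p a b ua ub = begin
    pathSum (suc t) a b
      ≈⟨ pathSum-suc t a b ⟩
    ∑ (configs N L) (λ c → 𝟙 (isStep a c) * (stepWeight a c * pathSum t c b))
      ≈⟨ ∑-steps-cong q a ua (λ c uc → pathSum≈spectralSum t p c b uc ub) ⟩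
    ∑ (configs N L) (λ c → 𝟙 (isStep a c) * (stepWeight a c * spectralSum t q p c b))
      ≈⟨ ∑-cong (configs N L) (λ c → trans (*-congˡ (trans (*-distribˡ-∑ (Kset K N) _ _) (∑-cong (Kset K N) (λ k →
           trans (*-congˡ (*-assoc _ _ _)) (sym (*-assoc _ _ _)))))) (*-distribˡ-∑ (Kset K N) _ _)) ⟩
    ∑ (configs N L) (λ c → ∑ (Kset K N) (λ k → 𝟙 (isStep a c) * ((stepWeight a c * Edet R (Rv q) k c) * later k)))
      ≈⟨ ∑-comm (configs N L) (Kset K N) _ ⟩
    ∑ (Kset K N) (λ k → ∑ (configs N L) (λ c → 𝟙 (isStep a c) * ((stepWeight a c * Edet R (Rv q) k c) * later k)))
      ≈⟨ ∑-cong (Kset K N) (λ k → trans (∑-cong (configs N L) (λ c → sym (*-assoc _ _ _))) (sym (*-distribʳ-∑ (configs N L) _ _))) ⟩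
    ∑ (Kset K N) (λ k → ∑ (configs N L) (λ c → 𝟙 (isStep a c) * (stepWeight a c * Edet R (Rv q) k c)) * later k)
      ≈⟨ ∑-cong (Kset K N) (λ k → *-congʳ (transfer-Edet q a ua k)) ⟩
    ∑ (Kset K N) (λ k → (Lam R lam k * Edet R (Rv (flipP q)) k a) * later k)
      ≈⟨ ∑-cong (Kset K N) (λ k → trans (sym (*-assoc _ _ _)) (*-congʳ (trans (*-congʳ (*-comm _ _)) (*-assoc _ _ _)))) ⟩
    spectralSum (suc t) (flipP q) p a b ∎
    where
    q = flipN t p
    later : Vec (Fin K) N → Carrier
    later k = pow R (Lam R lam k) t * conj (Edet R (Lv p) k b)

lemma3 : ∀ {c ℓ} (R : CommutativeRing c ℓ) (cj : Conj R) →
    let open CommutativeRing R in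
    (L N : ℕ) → parOf L ≡ o → 2 ≤ N →
    (w : ℕ → ℕ → Carrier) (v : ℕ → Carrier) (K : ℕ) (sd : Spectral R cj L w K) →
    (t : ℕ) (p p' : Par) → p' ≡ flipN t p →
    (yi yf : Vec ℕ N) → InU p' L yi → InU p L yf →
    Z R L N w v t yi yf ≈
      Vw R v yi * sumOver R (Kset K N) (λ k →
        Edet R (Spectral.Rv sd p') k yi * pow R (Lam R (Spectral.lam sd) k) t
          * Conj.conj cj (Edet R (Spectral.Lv sd p) k yf))
lemma3 R cj L N _ _ w v K sd t p .(flipN t p) P.refl yi yf ui uf = begin
  Z R L N w v t yi yf          ≈⟨ Z≈V*pathSum v t (flipN t p) yi yf ui ⟩
  Vw R v yi * pathSum t yi yf  ≈⟨ *-congˡ (pathSum≈spectralSum t p yi yf ui uf) ⟩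
  Vw R v yi * spectralSum t (flipN t p) p yi yf ∎
  where
  open CommutativeRing R
  open Paths R L w
  open Propagator R cj sd
  open import Relation.Binary.Reasoning.Setoid setoid
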